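{- Let $q$ be an odd prime power with $q \equiv 3 \pmod 4$, and let $V_q$ be the graph with vertex set $F_q^2$ in which distinct $X,Y$ are adjacent if and only if $Q(X,Y)$ is a nonzero square in $F_q$. Let $U$ be a set of $u$ vertices of $V_q$ and let $e(U)$ be the number of edges of $V_q$ with both endpoints in $U$. Then $$\left| e(U) - \frac{1}{2}\binom{u}{2} \right| \leq \frac{u}{4}\cdot\frac{q^2 - u}{q}.$$
   Context: $F_q$ is the finite field with $q$ elements; the quadrance of $[x_1,y_1],[x_2,y_2] \in F_q^2$ is $Q = (x_2-x_1)^2 + (y_2-y_1)^2$. -}

module Defs where

open import Level using (0ℓ)
open import Data.Nat as ℕ using (ℕ; suc; _≥_)
open import Data.Nat.Primality using (Prime)
open import Data.Fin using (Fin)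
open import Data.Product using (Σ; ∃; _×_; _,_)
open import Data.List using (List; []; _∷_; length; filter)
open import Data.Vec.Functional using (Vector)
open import Data.Bool using (Bool; true; false)
open import Data.Integer as ℤ using (ℤ)
open import Relation.Nullary using (¬_; Dec; yes; no)
open import Relation.Nullary.Decidable using (_×-dec_; ¬?)
open import Relation.Unary using (Decidable)
open import Relation.Binary.PropositionalEquality using (_≡_)
open import Function.Bundles using (_↔_)
import Algebra.Structures as S
open import Data.List.Relation.Unary.Any using (any?)
open import Data.List using (allFin) renaming (map to lmap)

record FiniteField (q : ℕ) : Set₁ where
  field
    Carrier : Set
    _+_ _*_ : Carrier → Carrier → Carrier
    -_ : Carrier → Carrier
    0# 1# : Carrier
    isCommutativeRing : S.IsCommutativeRing _≡_ _+_ _*_ -_ 0# 1#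
    0≢1 : ¬ (0# ≡ 1#)
    inverse : ∀ x → ¬ (x ≡ 0#) → ∃ λ y → (x * y) ≡ 1#
    _≟_ : (x y : Carrier) → Dec (x ≡ y)
    enumeration : Fin q ↔ Carrier

  Point : Set
  Point = Carrier × Carrier

  quadrance : Point → Point → Carrier
  quadrance (x₁ , y₁) (x₂ , y₂) =
    ((x₂ + (- x₁)) * (x₂ + (- x₁))) + ((y₂ + (- y₁)) * (y₂ + (- y₁)))

  IsSquare : Carrier → Set
  IsSquare a = ∃ λ b → (b * b) ≡ a

  Adjacent : Point → Point → Set
  Adjacent X Y = ¬ (X ≡ Y) × ¬ (quadrance X Y ≡ 0#) × IsSquare (quadrance X Y)

  _≟P_ : (X Y : Point) → Dec (X ≡ Y)
  (a , b) ≟P (c , d) with a ≟ c | b ≟ d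
  ... | yes Relation.Binary.PropositionalEquality.refl | yes Relation.Binary.PropositionalEquality.refl = yes Relation.Binary.PropositionalEquality.refl
  ... | no p | _ = no λ { Relation.Binary.PropositionalEquality.refl → p Relation.Binary.PropositionalEquality.refl }
  ... | yes _ | no p = no λ { Relation.Binary.PropositionalEquality.refl → p Relation.Binary.PropositionalEquality.refl }

  isSquare? : (a : Carrier) → Dec (IsSquare a)
  isSquare? a with any? (λ b → (b * b) ≟ a) (lmap (Function.Bundles.Inverse.to enumeration) (allFin q))
  ... | yes p = yes (witness p)
    where
    open import Data.List.Relation.Unary.Any using (Any; here; there)
    witness : ∀ {xs} → Any (λ b → (b * b) ≡ a) xs → IsSquare a
    witness (here px) = _ , px
    witness (there p) = witness p
  ... | no ¬p = no λ { (b , eq) → ¬p (found b eq) }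
    where
    open import Data.List.Relation.Unary.Any using (Any; here; there)
    open import Data.List.Membership.Propositional.Properties using (∈-map⁺; ∈-allFin)
    open import Data.List.Relation.Unary.Any.Properties using (map⁺)
    open Function.Bundles.Inverse enumeration
    open import Relation.Binary.PropositionalEquality using (subst; sym)
    found : ∀ b → (b * b) ≡ a → Any (λ c → (c * c) ≡ a) (lmap to (allFin q))
    found b eq = Data.List.Relation.Unary.Any.map
      (λ {c} c≡ → subst (λ z → (z * z) ≡ a) c≡ eq')
      (∈-map⁺ to (∈-allFin (from b)))
      where
      eq' : (to (from b) * to (from b)) ≡ a
      eq' = subst (λ z → (z * z) ≡ a) (sym (strictlyInverseˡ b)) eq

  adjacent? : (X Y : Point) → Dec (Adjacent X Y)
  adjacent? X Y = ¬? (X ≟P Y) ×-dec (¬? (quadrance X Y ≟ 0#) ×-dec isSquare? (quadrance X Y))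

  -- e(U): number of edges with both endpoints in U, U given as a list
  -- (duplicate-free) of vertices; counts pairs i < j of positions.
  edges : List Point → ℕ
  edges [] = 0
  edges (X ∷ Xs) = length (filter (adjacent? X) Xs) ℕ.+ edges Xs

IsPrimePower : ℕ → Set
IsPrimePower q = Σ ℕ λ p → Σ ℕ λ k → Prime p × k ≥ 1 × q ≡ p ℕ.^ k

{-# OPTIONS --safe #-}
module Submission where

-- As q ≡ 3 (mod 4), -1 is a nonsquare in 𝔽 = F_q, so 𝔽² is the field 𝔽[i] with q² elements
-- and the quadrance of X and Y is the norm N (Y - X). The multiplicative character
-- η = χ ∘ N (χ the quadratic character of 𝔽) is nontrivial, so ∑ η = 0 and the Jacobi
-- sums ∑_z η z η (z - d) equal -1 for d ≠ 0. Hence the matrix A X Y = η (Y - X), which is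
-- 1 on edges, -1 on other pairs of distinct points and 0 on the diagonal, has zero column
-- sums and AᵀA = q² I - J: A acts as ±q on vectors orthogonal to the all-ones vector.
-- For the indicator x of U this gives |q xᵀAx| ≤ q² |U| - |U|², and xᵀAx counts
-- 2 (2 e(U) - C(|U|, 2)).

open import Level using (0ℓ)
open import Function using (_∘_; _↔_; Inverse; Injection; mk↔ₛ′; _⟨_⟩_)
open import Function.Properties.Inverse using (↔-trans; ↔-sym; ↔⇒↣)
open import Data.Product.Function.NonDependent.Propositional using (_×-↔_)
open import Data.Nat as ℕ using (ℕ; zero; suc; NonZero; _%_)
open import Data.Fin as Fin using (Fin; toℕ)
import Data.Fin.Properties as Finₚ
import Data.Nat.Properties as ℕₚ
import Data.Nat.DivMod as DivMod
open import Data.Fin.Permutation using (Permutation)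
open import Data.Integer using (ℤ; 0ℤ; 1ℤ; -1ℤ; +_; -[1+_]; +[1+_]; ∣_∣; +≤+; -≤+; Positive)
import Data.Integer.Properties as ℤₚ
open import Data.Integer.Tactic.RingSolver using (solve-∀)
import Algebra.Properties.Semiring.Sum
open import Data.Product using (∃-syntax; _,_; proj₁; proj₂)
open import Data.Sum using (_⊎_; inj₁; inj₂; [_,_])
open import Data.List using (List; []; _∷_; length)
open import Data.List.Relation.Unary.All using (All; []; _∷_)
open import Data.List.Relation.Unary.Unique.Propositional using (Unique; []; _∷_)
open import Relation.Nullary using (¬_; Dec; yes; no; contradiction)
open import Relation.Binary.Definitions using (DecidableEquality)
open import Relation.Binary.PropositionalEquality
  using (_≡_; _≢_; refl; sym; trans; cong; cong₂; subst; subst₂; isEquivalence; module ≡-Reasoning)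
open import Algebra.Bundles using (CommutativeRing)
open import Algebra.Structures using (IsCommutativeRing)
open import Data.Maybe using (Maybe; just; nothing)
import Algebra.Solver.Ring.AlmostCommutativeRing as ACR
open import Defs

module FiniteSum {E : Set} {m : ℕ} (enum : Fin m ↔ E) (_≟_ : DecidableEquality E) where
  open import Data.Integer using (_+_; _*_; -_; _-_; _≤_)
  open Inverse enum using (to; from; strictlyInverseˡ; strictlyInverseʳ)
  private
    module FinSum = Algebra.Properties.Semiring.Sum ℤₚ.+-*-semiring
  open FinSum using (sum)

  opaque
    ∑ : (E → ℤ) → ℤ
    ∑ f = sum (f ∘ to)

  δ : E → E → ℤ
  δ a x with x ≟ a
  ... | yes _ = 1ℤ
  ... | no _ = 0ℤ

  δ-on : ∀ {a x} → x ≡ a → δ a x ≡ 1ℤ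
  δ-on {a} {x} x≡a with x ≟ a
  ... | yes _ = refl
  ... | no x≢a = contradiction x≡a x≢a

  δ-off : ∀ {a x} → x ≢ a → δ a x ≡ 0ℤ
  δ-off {a} {x} x≢a with x ≟ a
  ... | yes x≡a = contradiction x≡a x≢a
  ... | no _ = refl

  private
    sum-const : ∀ n c → sum {n} (λ _ → c) ≡ + n * c
    sum-const zero c = refl
    sum-const (suc n) c = trans (cong (_+_ c) (sum-const n c)) (c+kc≡[1+k]c c (+ n))
      where
      c+kc≡[1+k]c : ∀ c k → c + k * c ≡ (1ℤ + k) * c
      c+kc≡[1+k]c = solve-∀

    sum-single : ∀ {n} (t : Fin n → ℤ) k → (∀ i → i ≢ k → t i ≡ 0ℤ) → sum t ≡ t k
    sum-single {suc n} t k t≡0 = begin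
      sum t                         ≡⟨ FinSum.sum-remove t ⟩
      t k + sum (t ∘ Fin.punchIn k) ≡⟨ cong (_+_ (t k)) (FinSum.sum-cong-≗ (λ i → t≡0 _ (Finₚ.punchInᵢ≢i k i))) ⟩
      t k + sum {n} (λ _ → 0ℤ)      ≡⟨ cong (_+_ (t k)) (trans (sum-const n 0ℤ) (ℤₚ.*-zeroʳ (+ n))) ⟩
      t k + 0ℤ                      ≡⟨ ℤₚ.+-identityʳ (t k) ⟩
      t k                           ∎
      where open ≡-Reasoning

    sum-mono : ∀ {n} {f g : Fin n → ℤ} → (∀ i → f i ≤ g i) → sum f ≤ sum g
    sum-mono {zero} f≤g = ℤₚ.≤-refl
    sum-mono {suc n} f≤g = ℤₚ.+-mono-≤ (f≤g Fin.zero) (sum-mono (f≤g ∘ Fin.suc))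

    sum-≤-at : ∀ {n} (t : Fin n → ℤ) k → (∀ i → t i ≤ 0ℤ) → sum t ≤ t k
    sum-≤-at {suc n} t k t≤0 = begin
      sum t                          ≡⟨ FinSum.sum-remove t ⟩
      t k + sum (t ∘ Fin.punchIn k)  ≤⟨ ℤₚ.+-monoʳ-≤ (t k) (sum-mono (t≤0 ∘ Fin.punchIn k)) ⟩
      t k + sum {n} (λ _ → 0ℤ)       ≡⟨ cong (_+_ (t k)) (trans (sum-const n 0ℤ) (ℤₚ.*-zeroʳ (+ n))) ⟩
      t k + 0ℤ                       ≡⟨ ℤₚ.+-identityʳ (t k) ⟩
      t k                            ∎
      where open ℤₚ.≤-Reasoning

    from-injective : ∀ {x y} → from x ≡ from y → x ≡ y
    from-injective = Injection.injective (↔⇒↣ (↔-sym enum))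

  opaque
    unfolding ∑

    ∑-cong : ∀ {f g : E → ℤ} → (∀ x → f x ≡ g x) → ∑ f ≡ ∑ g
    ∑-cong f≗g = FinSum.sum-cong-≗ (f≗g ∘ to)

    ∑-+ : ∀ (f g : E → ℤ) → ∑ (λ x → f x + g x) ≡ ∑ f + ∑ g
    ∑-+ f g = FinSum.∑-distrib-+ (f ∘ to) (g ∘ to)

    ∑-*ˡ : ∀ c (f : E → ℤ) → ∑ (λ x → c * f x) ≡ c * ∑ f
    ∑-*ˡ c f = sym (FinSum.*-distribˡ-sum c (f ∘ to))

    ∑-const : ∀ c → ∑ (λ _ → c) ≡ + m * c
    ∑-const = sum-const m

    ∑-comm : ∀ (f : E → E → ℤ) → ∑ (λ x → ∑ (f x)) ≡ ∑ (λ y → ∑ (λ x → f x y))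
    ∑-comm f = FinSum.∑-comm (λ i j → f (to i) (to j))

    ∑-mono : ∀ {f g : E → ℤ} → (∀ x → f x ≤ g x) → ∑ f ≤ ∑ g
    ∑-mono f≤g = sum-mono (f≤g ∘ to)

    ∑-reindex : ∀ (σ : E ↔ E) (f : E → ℤ) → ∑ (f ∘ Inverse.to σ) ≡ ∑ f
    ∑-reindex σ f = sym (trans (FinSum.sum-permute (f ∘ to) π) (∑-cong (cong f ∘ strictlyInverseˡ ∘ Inverse.to σ)))
      where
      π : Permutation m m
      π = ↔-trans enum (↔-trans σ (↔-sym enum))

    ∑-single : ∀ (f : E → ℤ) a → (∀ x → x ≢ a → f x ≡ 0ℤ) → ∑ f ≡ f a
    ∑-single f a f≡0 = trans (sum-single (f ∘ to) (from a) to≢a⇒0) (cong f (strictlyInverseˡ a))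
      where
      to≢a⇒0 : ∀ i → i ≢ from a → f (to i) ≡ 0ℤ
      to≢a⇒0 i i≢ = f≡0 (to i) (λ to-i≡a → i≢ (trans (sym (strictlyInverseʳ i)) (cong from to-i≡a)))

    ∑-≤-at : ∀ (f : E → ℤ) a → (∀ x → f x ≤ 0ℤ) → ∑ f ≤ f a
    ∑-≤-at f a f≤0 = subst (∑ f ≤_) (cong f (strictlyInverseˡ a)) (sum-≤-at (f ∘ to) (from a) (f≤0 ∘ to))

  ∑-*ʳ : ∀ (f : E → ℤ) c → ∑ (λ x → f x * c) ≡ ∑ f * c
  ∑-*ʳ f c = trans (∑-cong (λ x → ℤₚ.*-comm (f x) c)) (trans (∑-*ˡ c f) (ℤₚ.*-comm c (∑ f)))

  ∑-zero : ∑ (λ _ → 0ℤ) ≡ 0ℤ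
  ∑-zero = trans (∑-const 0ℤ) (ℤₚ.*-zeroʳ (+ m))

  ∑-δ* : ∀ a (f : E → ℤ) → ∑ (λ x → δ a x * f x) ≡ f a
  ∑-δ* a f = trans (∑-single _ a (λ x x≢a → cong (_* f x) (δ-off x≢a))) (trans (cong (_* f a) (δ-on refl)) (ℤₚ.*-identityˡ (f a)))

  ∑-δ : ∀ a → ∑ (δ a) ≡ 1ℤ
  ∑-δ a = trans (∑-cong (λ x → sym (ℤₚ.*-identityʳ (δ a x)))) (∑-δ* a (λ _ → 1ℤ))

  ∑-δ′ : ∀ x → ∑ (λ a → δ a x) ≡ 1ℤ
  ∑-δ′ x = trans (∑-single (λ a → δ a x) x (λ a a≢x → δ-off (a≢x ∘ sym))) (δ-on refl)

  ∑-square : ∀ a b c (f g : E → ℤ) →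
    ∑ (λ x → (a * f x + b + c * g x) * (a * f x + b + c * g x))
      ≡ a * a * ∑ (λ x → f x * f x) + + 2 * a * b * ∑ f + + m * (b * b)
        + + 2 * a * c * ∑ (λ x → f x * g x) + + 2 * b * c * ∑ g + c * c * ∑ (λ x → g x * g x)
  ∑-square a b c f g = begin
    _                                               ≡⟨ ∑-cong (λ x → expand a b c (f x) (g x)) ⟩
    ∑ (λ x → t₁₋₅ x + c * c * g² x)                 ≡⟨ ∑-+ t₁₋₅ (λ x → c * c * g² x) ⟩
    ∑ t₁₋₅ + ∑ (λ x → c * c * g² x)                 ≡⟨ cong₂ _+_ ∑t₁₋₅ (∑-*ˡ (c * c) g²) ⟩
    _                                               ∎
    where
    open ≡-Reasoning
    f² fg g² t₁₋₂ t₁₋₃ t₁₋₄ t₁₋₅ : E → ℤ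
    f² x = f x * f x
    fg x = f x * g x
    g² x = g x * g x
    t₁₋₂ x = a * a * f² x + + 2 * a * b * f x
    t₁₋₃ x = t₁₋₂ x + b * b
    t₁₋₄ x = t₁₋₃ x + + 2 * a * c * fg x
    t₁₋₅ x = t₁₋₄ x + + 2 * b * c * g x

    ∑t₁₋₅ : ∑ t₁₋₅ ≡ a * a * ∑ f² + + 2 * a * b * ∑ f + + m * (b * b)
                     + + 2 * a * c * ∑ fg + + 2 * b * c * ∑ g
    ∑t₁₋₅ = trans (∑-+ t₁₋₄ (λ x → + 2 * b * c * g x)) (cong₂ _+_
             (trans (∑-+ t₁₋₃ (λ x → + 2 * a * c * fg x)) (cong₂ _+_
               (trans (∑-+ t₁₋₂ (λ _ → b * b)) (cong₂ _+_
                 (trans (∑-+ (λ x → a * a * f² x) (λ x → + 2 * a * b * f x))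
                        (cong₂ _+_ (∑-*ˡ (a * a) f²) (∑-*ˡ (+ 2 * a * b) f)))
                 (∑-const (b * b))))
               (∑-*ˡ (+ 2 * a * c) fg)))
             (∑-*ˡ (+ 2 * b * c) g))

    expand : ∀ a b c u v → (a * u + b + c * v) * (a * u + b + c * v)
                           ≡ a * a * (u * u) + + 2 * a * b * u + b * b
                             + + 2 * a * c * (u * v) + + 2 * b * c * v + c * c * (v * v)
    expand = solve-∀

  ∑-neg : ∀ (f : E → ℤ) → ∑ (λ x → - f x) ≡ - ∑ f
  ∑-neg f = trans (∑-cong (λ x → sym (ℤₚ.-1*i≡-i (f x)))) (trans (∑-*ˡ -1ℤ f) (ℤₚ.-1*i≡-i (∑ f)))

  ∑-square-nonneg : ∀ (f : E → ℤ) → 0ℤ ≤ ∑ (λ x → f x * f x)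
  ∑-square-nonneg f = subst (_≤ ∑ (λ x → f x * f x)) ∑-zero (∑-mono (λ x → square-nonneg (f x)))
    where
    square-nonneg : ∀ i → 0ℤ ≤ i * i
    square-nonneg (+ n) = subst (0ℤ ≤_) (ℤₚ.pos-* n n) (+≤+ ℕ.z≤n)
    square-nonneg -[1+ n ] = +≤+ ℕ.z≤n

  involution : ∀ (σ : E → E) → (∀ x → σ (σ x) ≡ x) → E ↔ E
  involution σ σσ = mk↔ₛ′ σ σ σσ σσ

  -- Each σ-orbit {x, σ x} with x ≠ σ x contributes g x twice: charge it to the
  -- element with the smaller index.
  ∑-even : ∀ (σ : E → E) (σσ : ∀ x → σ (σ x) ≡ x) (g : E → ℤ) →
           (∀ x → g (σ x) ≡ g x) → (∀ x → σ x ≡ x → g x ≡ 0ℤ) → ∃[ h ] ∑ g ≡ + 2 * h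
  ∑-even σ σσ g g∘σ≗g g-fixed≡0 = ∑ half , (begin
    ∑ g                           ≡⟨ ∑-cong split ⟩
    ∑ (λ x → half x + half (σ x)) ≡⟨ ∑-+ half (half ∘ σ) ⟩
    ∑ half + ∑ (half ∘ σ)         ≡⟨ cong (_+_ (∑ half)) (∑-reindex (involution σ σσ) half) ⟩
    ∑ half + ∑ half               ≡⟨ a+a≡2a (∑ half) ⟩
    + 2 * ∑ half                  ∎)
    where
    open ≡-Reasoning
    a+a≡2a : ∀ a → a + a ≡ + 2 * a
    a+a≡2a = solve-∀

    half : E → ℤ
    half x with from x Fin.<? from (σ x)
    ... | yes _ = g x
    ... | no _ = 0ℤ

    split : ∀ x → g x ≡ half x + half (σ x)
    split x with from x Fin.<? from (σ x) | from (σ x) Fin.<? from (σ (σ x))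
    ... | yes x<σx | yes σx<x = contradiction (subst (λ y → from (σ x) Fin.< from y) (σσ x) σx<x) (Finₚ.<-asym x<σx)
    ... | yes _ | no _ = sym (ℤₚ.+-identityʳ (g x))
    ... | no _ | yes _ = sym (trans (ℤₚ.+-identityˡ (g (σ x))) (g∘σ≗g x))
    ... | no x≮σx | no σx≮x = g-fixed≡0 x (sym (from-injective (Finₚ.≤-antisym x≤σx (ℕₚ.≮⇒≥ x≮σx))))
      where
      x≤σx : from x Fin.≤ from (σ x)
      x≤σx = subst (λ y → from y Fin.≤ from (σ x)) (σσ x) (ℕₚ.≮⇒≥ σx≮x)

module QuadraticForm {E : Set} {Q : ℕ} (enum : Fin (Q ℕ.* Q) ↔ E) (_≟_ : DecidableEquality E) where
  open import Data.Integer using (_+_; _*_; -_; _-_; _≤_)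
  open FiniteSum enum _≟_

  M : ℤ
  M = + (Q ℕ.* Q)

  module Bound (A : E → E → ℤ)
               (∑-column : ∀ Y → ∑ (λ X → A X Y) ≡ 0ℤ)
               (∑-gram : ∀ Y Z → ∑ (λ X → A X Y * A X Z) ≡ M * δ Y Z - 1ℤ)
               where

    A·_ : (E → ℤ) → E → ℤ
    (A· x) X = ∑ (λ Y → A X Y * x Y)

    ∑-A· : ∀ x → ∑ (A· x) ≡ 0ℤ
    ∑-A· x = begin
      ∑ (λ X → ∑ (λ Y → A X Y * x Y))  ≡⟨ ∑-comm (λ X Y → A X Y * x Y) ⟩
      ∑ (λ Y → ∑ (λ X → A X Y * x Y))  ≡⟨ ∑-cong (λ Y → trans (∑-*ʳ (λ X → A X Y) (x Y)) (cong (_* x Y) (∑-column Y))) ⟩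
      ∑ (λ Y → 0ℤ * x Y)               ≡⟨ ∑-cong (λ Y → ℤₚ.*-zeroˡ (x Y)) ⟨ trans ⟩ ∑-zero ⟩
      0ℤ                               ∎
      where open ≡-Reasoning

    ∑-A·² : ∀ x → ∑ (λ X → (A· x) X * (A· x) X) ≡ M * ∑ (λ X → x X * x X) - ∑ x * ∑ x
    ∑-A·² x = begin
      ∑ (λ X → (A· x) X * (A· x) X)
        ≡⟨ ∑-cong (λ X → trans (sym (∑-*ʳ (λ Y → A X Y * x Y) ((A· x) X)))
                               (∑-cong (λ Y → sym (∑-*ˡ (A X Y * x Y) (λ Z → A X Z * x Z))))) ⟩
      ∑ (λ X → ∑ (λ Y → ∑ (λ Z → A X Y * x Y * (A X Z * x Z))))
        ≡⟨ ∑-comm _ ⟨ trans ⟩ ∑-cong (λ Y → ∑-comm _) ⟩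
      ∑ (λ Y → ∑ (λ Z → ∑ (λ X → A X Y * x Y * (A X Z * x Z))))
        ≡⟨ ∑-cong (λ Y → ∑-cong (λ Z → pull-out Y Z)) ⟩
      ∑ (λ Y → ∑ (λ Z → M * (δ Y Z * (x Y * x Z)) - x Y * x Z))
        ≡⟨ ∑-cong row ⟩
      ∑ (λ Y → M * (x Y * x Y) - ∑ x * x Y)
        ≡⟨ ∑-+ _ _ ⟨ trans ⟩ cong₂ _+_ (∑-*ˡ M _) (∑-neg-*ˡ (∑ x) x) ⟩
      M * ∑ (λ X → x X * x X) - ∑ x * ∑ x
        ∎
      where
      open ≡-Reasoning
      ∑-neg-*ˡ : ∀ c (f : E → ℤ) → ∑ (λ X → - (c * f X)) ≡ - (c * ∑ f)
      ∑-neg-*ˡ c f = trans (∑-neg (λ X → c * f X)) (cong -_ (∑-*ˡ c f))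

      pull-out : ∀ Y Z → ∑ (λ X → A X Y * x Y * (A X Z * x Z)) ≡ M * (δ Y Z * (x Y * x Z)) - x Y * x Z
      pull-out Y Z = begin
        ∑ (λ X → A X Y * x Y * (A X Z * x Z))  ≡⟨ ∑-cong (λ X → regroup (A X Y) (x Y) (A X Z) (x Z)) ⟩
        ∑ (λ X → A X Y * A X Z * (x Y * x Z))  ≡⟨ ∑-*ʳ (λ X → A X Y * A X Z) (x Y * x Z) ⟩
        ∑ (λ X → A X Y * A X Z) * (x Y * x Z)  ≡⟨ cong (_* (x Y * x Z)) (∑-gram Y Z) ⟩
        (M * δ Y Z - 1ℤ) * (x Y * x Z)          ≡⟨ distribute M (δ Y Z) (x Y * x Z) ⟩
        M * (δ Y Z * (x Y * x Z)) - x Y * x Z  ∎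
        where
        regroup : ∀ a b c d → a * b * (c * d) ≡ a * c * (b * d)
        regroup = solve-∀
        distribute : ∀ m d p → (m * d - 1ℤ) * p ≡ m * (d * p) - p
        distribute = solve-∀

      row : ∀ Y → ∑ (λ Z → M * (δ Y Z * (x Y * x Z)) - x Y * x Z) ≡ M * (x Y * x Y) - ∑ x * x Y
      row Y = begin
        ∑ (λ Z → M * (δ Y Z * (x Y * x Z)) - x Y * x Z)
          ≡⟨ ∑-+ _ _ ⟨ trans ⟩ cong₂ _+_ (∑-*ˡ M _) (∑-neg-*ˡ (x Y) x) ⟩
        M * ∑ (λ Z → δ Y Z * (x Y * x Z)) - x Y * ∑ x
          ≡⟨ cong₂ (λ t u → M * t - u) (∑-δ* Y (λ Z → x Y * x Z)) (ℤₚ.*-comm (x Y) (∑ x)) ⟩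
        M * (x Y * x Y) - ∑ x * x Y
          ∎

    module _ (x : E → ℤ) where
      private
        s D T : ℤ
        s = ∑ x
        D = ∑ (λ X → x X * x X)
        T = ∑ (λ X → x X * (A· x) X)

      residual : ℤ → E → ℤ
      residual ε X = M * x X + - s + - (ε * + Q) * (A· x) X

      -- Chosen so that, by ∑ (A· x) = 0 and ∑ (A· x)² = M D - s², its squared length is
      -- exactly 2M times the slack of the bound.
      ∑-residual² : ∀ ε → ε * ε ≡ 1ℤ →
        ∑ (λ X → residual ε X * residual ε X) ≡ + 2 * M * (M * D - s * s - ε * (+ Q * T))
      ∑-residual² ε ε²≡1 = begin
        _ ≡⟨ ∑-square M (- s) c x (A· x) ⟩
        M * M * D + + 2 * M * - s * s + M * (- s * - s) + + 2 * M * c * T + + 2 * - s * c * ∑ (A· x) + c * c * ∑ (λ X → (A· x) X * (A· x) X)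
          ≡⟨ cong₂ (λ t u → M * M * D + + 2 * M * - s * s + M * (- s * - s) + + 2 * M * c * T + + 2 * - s * c * t + u)
                   (∑-A· x) (cong₂ _*_ c²≡Q² (∑-A·² x)) ⟩
        M * M * D + + 2 * M * - s * s + M * (- s * - s) + + 2 * M * c * T + + 2 * - s * c * 0ℤ + + Q * + Q * (M * D - s * s)
          ≡⟨ collect M (+ Q) ε D s T (ℤₚ.pos-* Q Q) ⟩
        + 2 * M * (M * D - s * s - ε * (+ Q * T)) ∎
        where
        open ≡-Reasoning
        c : ℤ
        c = - (ε * + Q)
        c²≡Q² : c * c ≡ + Q * + Q
        c²≡Q² = trans (square-neg ε (+ Q)) (trans (cong (_* (+ Q * + Q)) ε²≡1) (ℤₚ.*-identityˡ (+ Q * + Q)))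
          where
          square-neg : ∀ e q → - (e * q) * - (e * q) ≡ e * e * (q * q)
          square-neg = solve-∀
        collect : ∀ M q ε D s T → M ≡ q * q →
          M * M * D + + 2 * M * - s * s + M * (- s * - s) + + 2 * M * - (ε * q) * T + + 2 * - s * - (ε * q) * 0ℤ + q * q * (M * D - s * s)
            ≡ + 2 * M * (M * D - s * s - ε * (q * T))
        collect .(q * q) q ε D s T refl = polynomial q ε D s T
          where
          polynomial : ∀ q ε D s T →
            q * q * (q * q) * D + + 2 * (q * q) * - s * s + q * q * (- s * - s) + + 2 * (q * q) * - (ε * q) * T
              + + 2 * - s * - (ε * q) * 0ℤ + q * q * (q * q * D - s * s)
              ≡ + 2 * (q * q) * (q * q * D - s * s - ε * (q * T))
          polynomial = solve-∀

      signed-bound : .{{_ : NonZero Q}} → ∀ ε → ε * ε ≡ 1ℤ → ε * (+ Q * T) ≤ M * D - s * s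
      signed-bound ε ε²≡1 = ℤₚ.0≤i-j⇒j≤i (ℤₚ.*-cancelˡ-≤-pos 0ℤ _ (+ 2 * M) {{2M-positive Q}}
        (subst₂ _≤_ (sym (ℤₚ.*-zeroʳ (+ 2 * M))) (∑-residual² ε ε²≡1) (∑-square-nonneg (residual ε))))
        where
        2M-positive : ∀ n → .{{NonZero n}} → Positive (+ 2 * + (n ℕ.* n))
        2M-positive (suc n) = _

    quadraticForm-bound : .{{_ : NonZero Q}} → ∀ x →
      + ∣ + Q * ∑ (λ X → x X * (A· x) X) ∣ ≤ M * ∑ (λ X → x X * x X) - ∑ x * ∑ x
    quadraticForm-bound x = ∣i∣≤j (subst (_≤ _) (ℤₚ.*-identityˡ _) (signed-bound x 1ℤ refl))
                                  (subst (_≤ _) (ℤₚ.-1*i≡-i _) (signed-bound x -1ℤ refl))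
      where
      ∣i∣≤j : ∀ {i j} → i ≤ j → - i ≤ j → + ∣ i ∣ ≤ j
      ∣i∣≤j {+ _} i≤j _ = i≤j
      ∣i∣≤j { -[1+ _ ]} _ -i≤j = -i≤j

module ListSum {E : Set} {m : ℕ} (enum : Fin m ↔ E) (_≟_ : DecidableEquality E) where
  open import Data.Integer using (_+_; _*_)
  open FiniteSum enum _≟_

  ∑ₗ : List E → (E → ℤ) → ℤ
  ∑ₗ [] f = 0ℤ
  ∑ₗ (X ∷ U) f = f X + ∑ₗ U f

  multiplicity : List E → E → ℤ
  multiplicity U X = ∑ₗ U (λ Y → δ Y X)

  pairSum : (E → E → ℤ) → List E → ℤ
  pairSum A [] = 0ℤ
  pairSum A (X ∷ U) = ∑ₗ U (A X) + pairSum A U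

  ∑ₗ-cong : ∀ U {f g : E → ℤ} → (∀ X → f X ≡ g X) → ∑ₗ U f ≡ ∑ₗ U g
  ∑ₗ-cong [] f≗g = refl
  ∑ₗ-cong (X ∷ U) f≗g = cong₂ _+_ (f≗g X) (∑ₗ-cong U f≗g)

  ∑ₗ-+ : ∀ U (f g : E → ℤ) → ∑ₗ U (λ X → f X + g X) ≡ ∑ₗ U f + ∑ₗ U g
  ∑ₗ-+ [] f g = refl
  ∑ₗ-+ (X ∷ U) f g = trans (cong (_+_ (f X + g X)) (∑ₗ-+ U f g)) (interchange (f X) (g X) (∑ₗ U f) (∑ₗ U g))
    where
    interchange : ∀ a b c d → a + b + (c + d) ≡ a + c + (b + d)
    interchange = solve-∀

  ∑ₗ-1 : ∀ U → ∑ₗ U (λ _ → 1ℤ) ≡ + length U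
  ∑ₗ-1 [] = refl
  ∑ₗ-1 (X ∷ U) = cong (_+_ 1ℤ) (∑ₗ-1 U)

  ∑ₗ-δ-absent : ∀ {Y} U → All (Y ≢_) U → ∑ₗ U (δ Y) ≡ 0ℤ
  ∑ₗ-δ-absent [] [] = refl
  ∑ₗ-δ-absent (X ∷ U) (Y≢X ∷ Y∉U) = cong₂ _+_ (δ-off (Y≢X ∘ sym)) (∑ₗ-δ-absent U Y∉U)

  multiplicity-absent : ∀ {Y} U → All (Y ≢_) U → multiplicity U Y ≡ 0ℤ
  multiplicity-absent [] [] = refl
  multiplicity-absent (X ∷ U) (Y≢X ∷ Y∉U) = cong₂ _+_ (δ-off Y≢X) (multiplicity-absent U Y∉U)

  ∑-multiplicity : ∀ U (f : E → ℤ) → ∑ (λ X → multiplicity U X * f X) ≡ ∑ₗ U f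
  ∑-multiplicity [] f = trans (∑-cong (λ X → ℤₚ.*-zeroˡ (f X))) ∑-zero
  ∑-multiplicity (Y ∷ U) f = begin
    ∑ (λ X → (δ Y X + multiplicity U X) * f X)
      ≡⟨ ∑-cong (λ X → ℤₚ.*-distribʳ-+ (f X) (δ Y X) (multiplicity U X)) ⟩
    ∑ (λ X → δ Y X * f X + multiplicity U X * f X)
      ≡⟨ ∑-+ (λ X → δ Y X * f X) (λ X → multiplicity U X * f X) ⟩
    ∑ (λ X → δ Y X * f X) + ∑ (λ X → multiplicity U X * f X)
      ≡⟨ cong₂ _+_ (∑-δ* Y f) (∑-multiplicity U f) ⟩
    f Y + ∑ₗ U f ∎
    where open ≡-Reasoning

  ∑ₗ-multiplicity : ∀ U → Unique U → ∑ₗ U (multiplicity U) ≡ + length U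
  ∑ₗ-multiplicity [] [] = refl
  ∑ₗ-multiplicity (Y ∷ U) (Y∉U ∷ U!) = begin
    δ Y Y + multiplicity U Y + ∑ₗ U (λ X → δ Y X + multiplicity U X)
      ≡⟨ cong₂ _+_ (cong₂ _+_ (δ-on refl) (multiplicity-absent U Y∉U)) (∑ₗ-+ U (δ Y) (multiplicity U)) ⟩
    1ℤ + 0ℤ + (∑ₗ U (δ Y) + ∑ₗ U (multiplicity U))
      ≡⟨ cong₂ (λ s t → 1ℤ + (s + t)) (∑ₗ-δ-absent U Y∉U) (∑ₗ-multiplicity U U!) ⟩
    1ℤ + (0ℤ + + length U)
      ≡⟨ cong (_+_ 1ℤ) (ℤₚ.+-identityˡ (+ length U)) ⟩
    + length (Y ∷ U) ∎
    where open ≡-Reasoning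

  ∑ₗ-∑ₗ≡2*pairSum : ∀ (A : E → E → ℤ) → (∀ X Y → A X Y ≡ A Y X) → (∀ X → A X X ≡ 0ℤ) →
                    ∀ U → ∑ₗ U (λ X → ∑ₗ U (A X)) ≡ + 2 * pairSum A U
  ∑ₗ-∑ₗ≡2*pairSum A A-sym A-diag [] = refl
  ∑ₗ-∑ₗ≡2*pairSum A A-sym A-diag (X ∷ U) = begin
    A X X + ∑ₗ U (A X) + ∑ₗ U (λ Y → A Y X + ∑ₗ U (A Y))
      ≡⟨ cong₂ _+_ (cong (_+ ∑ₗ U (A X)) (A-diag X)) (∑ₗ-+ U (λ Y → A Y X) (λ Y → ∑ₗ U (A Y))) ⟩
    0ℤ + ∑ₗ U (A X) + (∑ₗ U (λ Y → A Y X) + ∑ₗ U (λ Y → ∑ₗ U (A Y)))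
      ≡⟨ cong₂ (λ s t → 0ℤ + ∑ₗ U (A X) + (s + t)) (∑ₗ-cong U (λ Y → A-sym Y X)) (∑ₗ-∑ₗ≡2*pairSum A A-sym A-diag U) ⟩
    0ℤ + ∑ₗ U (A X) + (∑ₗ U (A X) + + 2 * pairSum A U)
      ≡⟨ collect (∑ₗ U (A X)) (pairSum A U) ⟩
    + 2 * (∑ₗ U (A X) + pairSum A U)
      ∎
    where
    open ≡-Reasoning
    collect : ∀ a p → 0ℤ + a + (a + + 2 * p) ≡ + 2 * (a + p)
    collect = solve-∀

module IntegerCoefficientSolver {A : Set} {plus times : A → A → A} {negate : A → A} {0ᴬ 1ᴬ : A}
  (isCommutativeRing : IsCommutativeRing _≡_ plus times negate 0ᴬ 1ᴬ) where
  private
    R : CommutativeRing 0ℓ 0ℓ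
    R = record { isCommutativeRing = isCommutativeRing }
  open CommutativeRing R
    using (_+_; _*_; -_; _-_; 0#; 1#; +-assoc; +-comm; +-identityˡ; +-identityʳ; -‿inverseʳ; ring; semiring)
  open import Algebra.Properties.Ring ring using (-0#≈0#; -‿involutive; -‿+-comm; -‿distribˡ-*; -‿distribʳ-*)
  open import Algebra.Properties.Semiring.Mult semiring using (_×_; ×-homo-+; ×1-homo-*)
  import Data.Integer as ℤ

  ι : ℤ → A
  ι (+ n) = n × 1#
  ι -[1+ n ] = - (suc n × 1#)

  ι-neg : ∀ i → ι (ℤ.- i) ≡ - ι i
  ι-neg (+ zero) = sym -0#≈0#
  ι-neg +[1+ n ] = refl
  ι-neg -[1+ n ] = sym (-‿involutive _)

  ι-⊖ : ∀ m n → ι (m ℤ.⊖ n) ≡ m × 1# - n × 1#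
  ι-⊖ m zero = sym (trans (cong (_+_ (m × 1#)) -0#≈0#) (+-identityʳ _))
  ι-⊖ zero (suc n) = sym (+-identityˡ _)
  ι-⊖ (suc m) (suc n) = trans (cong ι (ℤₚ.[1+m]⊖[1+n]≡m⊖n m n)) (trans (ι-⊖ m n) (begin
    a - b                       ≡⟨ cong (_+ - b) (sym (+-identityˡ a)) ⟩
    0# + a - b                  ≡⟨ cong (λ z → z + a - b) (sym (-‿inverseʳ 1#)) ⟩
    1# - 1# + a - b             ≡⟨ cong (_+ - b) (+-assoc 1# (- 1#) a) ⟩
    1# + (- 1# + a) - b         ≡⟨ cong (λ z → 1# + z - b) (+-comm (- 1#) a) ⟩
    1# + (a - 1#) - b           ≡⟨ cong (_+ - b) (sym (+-assoc 1# a (- 1#))) ⟩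
    1# + a - 1# - b             ≡⟨ +-assoc (1# + a) (- 1#) (- b) ⟩
    1# + a + (- 1# - b)         ≡⟨ cong (_+_ (1# + a)) (-‿+-comm 1# b) ⟩
    1# + a - (1# + b)           ∎))
    where
    open ≡-Reasoning
    a b : A
    a = m × 1#
    b = n × 1#

  ι-+ : ∀ i j → ι (i ℤ.+ j) ≡ ι i + ι j
  ι-+ (+ m) (+ n) = ×-homo-+ 1# m n
  ι-+ (+ m) -[1+ n ] = ι-⊖ m (suc n)
  ι-+ -[1+ m ] (+ n) = trans (ι-⊖ n (suc m)) (+-comm _ _)
  ι-+ -[1+ m ] -[1+ n ] = begin
    - (suc (suc m ℕ.+ n) × 1#)          ≡⟨ cong (λ k → - (k × 1#)) (sym (ℕₚ.+-suc (suc m) n)) ⟩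
    - ((suc m ℕ.+ suc n) × 1#)          ≡⟨ cong -_ (×-homo-+ 1# (suc m) (suc n)) ⟩
    - (suc m × 1# + suc n × 1#)         ≡⟨ sym (-‿+-comm _ _) ⟩
    - (suc m × 1#) + - (suc n × 1#)     ∎
    where open ≡-Reasoning

  ι-*⁺ : ∀ m j → ι (+ m ℤ.* j) ≡ ι (+ m) * ι j
  ι-*⁺ m (+ n) = trans (cong ι (sym (ℤₚ.pos-* m n))) (×1-homo-* m n)
  ι-*⁺ m -[1+ n ] = begin
    ι (+ m ℤ.* ℤ.- +[1+ n ])         ≡⟨ cong ι (sym (ℤₚ.neg-distribʳ-* (+ m) +[1+ n ])) ⟩
    ι (ℤ.- (+ m ℤ.* +[1+ n ]))       ≡⟨ ι-neg (+ m ℤ.* +[1+ n ]) ⟩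
    - ι (+ m ℤ.* +[1+ n ])           ≡⟨ cong -_ (ι-*⁺ m +[1+ n ]) ⟩
    - (ι (+ m) * ι +[1+ n ])         ≡⟨ -‿distribʳ-* _ _ ⟩
    ι (+ m) * - ι +[1+ n ]           ∎
    where open ≡-Reasoning

  ι-* : ∀ i j → ι (i ℤ.* j) ≡ ι i * ι j
  ι-* (+ m) j = ι-*⁺ m j
  ι-* -[1+ m ] j = begin
    ι (ℤ.- +[1+ m ] ℤ.* j)           ≡⟨ cong ι (sym (ℤₚ.neg-distribˡ-* +[1+ m ] j)) ⟩
    ι (ℤ.- (+[1+ m ] ℤ.* j))         ≡⟨ ι-neg (+[1+ m ] ℤ.* j) ⟩
    - ι (+[1+ m ] ℤ.* j)             ≡⟨ cong -_ (ι-*⁺ (suc m) j) ⟩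
    - (ι +[1+ m ] * ι j)             ≡⟨ -‿distribˡ-* _ _ ⟩
    - ι +[1+ m ] * ι j               ∎
    where open ≡-Reasoning

  ι-homomorphism : ℤ.+-*-rawRing ACR.-Raw-AlmostCommutative⟶ ACR.fromCommutativeRing R
  ι-homomorphism = record
    { ⟦_⟧ = ι ; +-homo = ι-+ ; *-homo = ι-* ; -‿homo = ι-neg ; 0-homo = refl ; 1-homo = +-identityʳ 1# }

  -- Coefficients are compared in ℤ, where equality computes.
  ι-≟ : ∀ i j → Maybe (ι i ≡ ι j)
  ι-≟ i j with i ℤ.≟ j
  ... | yes refl = just refl
  ... | no _ = nothing

  open import Algebra.Solver.Ring ℤ.+-*-rawRing (ACR.fromCommutativeRing R) ι-homomorphism ι-≟ public
    using (solve; _:=_; _:+_; _:*_; :-_; _:-_; con)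

module FieldTheory {n : ℕ} (K : FiniteField n) where
  open FiniteField K public hiding (_+_; _*_; -_)
  open FiniteSum enumeration _≟_ public

  commutativeRing : CommutativeRing 0ℓ 0ℓ
  commutativeRing = record { isCommutativeRing = isCommutativeRing }

  -- The ring operations, with the fixities the record fields of FiniteField lack.
  open CommutativeRing commutativeRing public
    using (_+_; _*_; -_; _-_; ring; semiring; +-assoc; +-comm; +-identityˡ; +-identityʳ; -‿inverseʳ;
           -‿inverseˡ; *-assoc; *-comm; *-identityˡ; *-identityʳ; distribʳ; zeroˡ; zeroʳ)
  open IntegerCoefficientSolver isCommutativeRing public using (solve; _:=_; _:+_; _:*_; :-_; _:-_; con)
  open import Algebra.Properties.Ring ring public using (+-cancelˡ; +-inverseʳ-unique; -0#≈0#; -‿involutive; -1*x≈-x)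
  open import Algebra.Properties.Semiring.Mult semiring public using (_×_; ×-homo-+)

  infix 9 _⁻¹

  -- Total inverse with the junk value 0 ⁻¹ = 0.
  _⁻¹ : Carrier → Carrier
  x ⁻¹ with x ≟ 0#
  ... | yes _ = 0#
  ... | no x≢0 = proj₁ (inverse x x≢0)

  x*x⁻¹≡1 : ∀ {x} → x ≢ 0# → x * x ⁻¹ ≡ 1#
  x*x⁻¹≡1 {x} x≢0 with x ≟ 0#
  ... | yes x≡0 = contradiction x≡0 x≢0
  ... | no x≢0 = proj₂ (inverse x x≢0)

  x⁻¹*x≡1 : ∀ {x} → x ≢ 0# → x ⁻¹ * x ≡ 1#
  x⁻¹*x≡1 {x} x≢0 = trans (*-comm (x ⁻¹) x) (x*x⁻¹≡1 x≢0)

  0⁻¹≡0 : 0# ⁻¹ ≡ 0#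
  0⁻¹≡0 with 0# ≟ 0#
  ... | yes _ = refl
  ... | no 0≢0 = contradiction refl 0≢0

  x*[y*z]≡z : ∀ {x y} → x * y ≡ 1# → ∀ z → x * (y * z) ≡ z
  x*[y*z]≡z {x} {y} xy≡1 z = trans (sym (*-assoc x y z)) (trans (cong (_* z) xy≡1) (*-identityˡ z))

  x*y≡0⇒y≡0 : ∀ {x y} → x ≢ 0# → x * y ≡ 0# → y ≡ 0#
  x*y≡0⇒y≡0 {x} {y} x≢0 xy≡0 =
    trans (sym (x*[y*z]≡z (x⁻¹*x≡1 x≢0) y)) (trans (cong (x ⁻¹ *_) xy≡0) (zeroʳ (x ⁻¹)))

  x*y≢0 : ∀ {x y} → x ≢ 0# → y ≢ 0# → x * y ≢ 0#
  x*y≢0 x≢0 y≢0 xy≡0 = y≢0 (x*y≡0⇒y≡0 x≢0 xy≡0)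

  x*y≡1⇒y≡x⁻¹ : ∀ {x y} → x * y ≡ 1# → y ≡ x ⁻¹
  x*y≡1⇒y≡x⁻¹ {x} {y} xy≡1 =
    trans (sym (x*[y*z]≡z (x⁻¹*x≡1 x≢0) y)) (trans (cong (x ⁻¹ *_) xy≡1) (*-identityʳ (x ⁻¹)))
    where
    x≢0 : x ≢ 0#
    x≢0 x≡0 = 0≢1 (trans (sym (zeroˡ y)) (trans (cong (_* y) (sym x≡0)) xy≡1))

  ⁻¹-involutive : ∀ x → x ⁻¹ ⁻¹ ≡ x
  ⁻¹-involutive x = by-cases (x ≟ 0#)
    where
    by-cases : Dec (x ≡ 0#) → x ⁻¹ ⁻¹ ≡ x
    by-cases (yes refl) = trans (cong _⁻¹ 0⁻¹≡0) 0⁻¹≡0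
    by-cases (no x≢0) = sym (x*y≡1⇒y≡x⁻¹ (x⁻¹*x≡1 x≢0))

  ⁻¹-distrib-* : ∀ x y → (x * y) ⁻¹ ≡ x ⁻¹ * y ⁻¹
  ⁻¹-distrib-* x y = by-cases (x ≟ 0#) (y ≟ 0#)
    where
    by-cases : Dec (x ≡ 0#) → Dec (y ≡ 0#) → (x * y) ⁻¹ ≡ x ⁻¹ * y ⁻¹
    by-cases (yes refl) _ = begin
      (0# * y) ⁻¹   ≡⟨ cong _⁻¹ (zeroˡ y) ⟩
      0# ⁻¹         ≡⟨ 0⁻¹≡0 ⟩
      0#            ≡⟨ sym (zeroˡ (y ⁻¹)) ⟩
      0# * y ⁻¹     ≡⟨ cong (_* y ⁻¹) (sym 0⁻¹≡0) ⟩
      0# ⁻¹ * y ⁻¹  ∎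
      where open ≡-Reasoning
    by-cases (no _) (yes refl) = begin
      (x * 0#) ⁻¹   ≡⟨ cong _⁻¹ (zeroʳ x) ⟩
      0# ⁻¹         ≡⟨ 0⁻¹≡0 ⟩
      0#            ≡⟨ sym (zeroʳ (x ⁻¹)) ⟩
      x ⁻¹ * 0#     ≡⟨ cong (x ⁻¹ *_) (sym 0⁻¹≡0) ⟩
      x ⁻¹ * 0# ⁻¹  ∎
      where open ≡-Reasoning
    by-cases (no x≢0) (no y≢0) = sym (x*y≡1⇒y≡x⁻¹ (begin
      x * y * (x ⁻¹ * y ⁻¹)    ≡⟨ interchange x y (x ⁻¹) (y ⁻¹) ⟩
      x * x ⁻¹ * (y * y ⁻¹)    ≡⟨ cong₂ _*_ (x*x⁻¹≡1 x≢0) (x*x⁻¹≡1 y≢0) ⟩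
      1# * 1#                  ≡⟨ *-identityˡ 1# ⟩
      1#                       ∎))
      where
      open ≡-Reasoning
      interchange : ∀ a b c d → a * b * (c * d) ≡ a * c * (b * d)
      interchange = solve 4 (λ a b c d → a :* b :* (c :* d) := a :* c :* (b :* d)) refl

  x-y≡0⇒x≡y : ∀ {x y} → x - y ≡ 0# → x ≡ y
  x-y≡0⇒x≡y {x} {y} x-y≡0 = trans (x≡[x-y]+y x y) (trans (cong (_+ y) x-y≡0) (+-identityˡ y))
    where
    x≡[x-y]+y : ∀ x y → x ≡ x - y + y
    x≡[x-y]+y = solve 2 (λ x y → x := x :- y :+ y) refl

  ∑-scale : ∀ {a} → a ≢ 0# → (f : Carrier → ℤ) → ∑ (λ x → f (a * x)) ≡ ∑ f
  ∑-scale {a} a≢0 = ∑-reindex (mk↔ₛ′ (a *_) (a ⁻¹ *_) (x*[y*z]≡z (x*x⁻¹≡1 a≢0)) (x*[y*z]≡z (x⁻¹*x≡1 a≢0)))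

  ∑-reflect : ∀ y (f : Carrier → ℤ) → ∑ (λ x → f (y - x)) ≡ ∑ f
  ∑-reflect y = ∑-reindex (involution (_-_ y) y-[y-x]≡x)
    where
    y-[y-x]≡x : ∀ x → y - (y - x) ≡ x
    y-[y-x]≡x = solve 2 (λ y x → y :- (y :- x) := x) refl y

  characteristic : ∃[ e ] suc e × 1# ≡ 0#
  characteristic with Finₚ.pigeonhole (ℕₚ.n<1+n n) (λ i → from (toℕ i × 1#))
    where open Inverse enumeration using (from)
  ... | i , j , i<j , same-image = e , +-cancelˡ (toℕ i × 1#) _ _ (begin
    toℕ i × 1# + suc e × 1#   ≡⟨ sym (×-homo-+ 1# (toℕ i) (suc e)) ⟩
    (toℕ i ℕ.+ suc e) × 1#    ≡⟨ cong (_× 1#) (trans (ℕₚ.+-suc (toℕ i) e) (ℕₚ.m+[n∸m]≡n i<j)) ⟩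
    toℕ j × 1#                ≡⟨ Injection.injective (↔⇒↣ (↔-sym enumeration)) (sym same-image) ⟩
    toℕ i × 1#                ≡⟨ sym (+-identityʳ _) ⟩
    toℕ i × 1# + 0#           ∎)
    where
    open ≡-Reasoning
    e : ℕ
    e = toℕ j ℕ.∸ suc (toℕ i)

module QuadraticCharacter {q : ℕ} (𝔽 : FiniteField q) (q-odd : q % 2 ≡ 1) where
  open FieldTheory 𝔽
  open Inverse enumeration using (to; from; strictlyInverseˡ)
  open import Data.Integer using () renaming (_+_ to _+ℤ_; _*_ to _*ℤ_; -_ to -ℤ_; _-_ to _-ℤ_; _≤_ to _≤ℤ_)

  private
    q≢2*h : ∀ h → + q ≢ + 2 *ℤ h
    q≢2*h (+ k) q≡2k with trans (sym (DivMod.m*n%n≡0 k 2)) (trans (cong (_% 2) (sym q≡k*2)) q-odd)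
      where
      q≡k*2 : q ≡ k ℕ.* 2
      q≡k*2 = trans (ℤₚ.+-injective (trans q≡2k (sym (ℤₚ.pos-* 2 k)))) (ℕₚ.*-comm 2 k)
    ... | ()
    q≢2*h -[1+ k ] ()

  -- If 1 + 1 = 0, translation by 1 is a fixed-point-free involution, making q even.
  1+1≢0 : 1# + 1# ≢ 0#
  1+1≢0 1+1≡0 = q-odd⇒¬even (∑-even (_+ 1#) shift² (λ _ → 1ℤ) (λ _ → refl) no-fixed-point)
    where
    shift² : ∀ x → x + 1# + 1# ≡ x
    shift² x = trans (+-assoc x 1# 1#) (trans (cong (_+_ x) 1+1≡0) (+-identityʳ x))
    no-fixed-point : ∀ x → x + 1# ≡ x → 1ℤ ≡ 0ℤ
    no-fixed-point x x+1≡x = contradiction (sym (+-cancelˡ x 1# 0# (trans x+1≡x (sym (+-identityʳ x))))) 0≢1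
    q-odd⇒¬even : ¬ (∃[ h ] ∑ (λ _ → 1ℤ) ≡ + 2 *ℤ h)
    q-odd⇒¬even (h , ∑1≡2h) = q≢2*h h (trans (sym (ℤₚ.*-identityʳ (+ q))) (trans (sym (∑-const 1ℤ)) ∑1≡2h))

  x≢-x : ∀ {x} → x ≢ 0# → x ≢ - x
  x≢-x {x} x≢0 x≡-x = x≢0 (x*y≡0⇒y≡0 1+1≢0 (begin
    (1# + 1#) * x  ≡⟨ double x ⟩
    x + x          ≡⟨ cong (_+_ x) x≡-x ⟩
    x - x          ≡⟨ -‿inverseʳ x ⟩
    0#             ∎))
    where
    open ≡-Reasoning
    double : ∀ x → (1# + 1#) * x ≡ x + x
    double x = trans (distribʳ x 1# 1#) (cong₂ _+_ (*-identityˡ x) (*-identityˡ x))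

  square-roots : ∀ {x s} → x * x ≡ s * s → x ≡ s ⊎ x ≡ - s
  square-roots {x} {s} x²≡s² with x ≟ s
  ... | yes x≡s = inj₁ x≡s
  ... | no x≢s = inj₂ (begin
    x                  ≡⟨ x≡[x+s]-s x s ⟩
    x + s - s          ≡⟨ cong (_- s) (x*y≡0⇒y≡0 x-s≢0 (trans (difference-of-squares x s) (x≡y⇒x-y≡0 x²≡s²))) ⟩
    0# - s             ≡⟨ +-identityˡ (- s) ⟩
    - s                ∎)
    where
    open ≡-Reasoning
    x≡[x+s]-s : ∀ x s → x ≡ x + s - s
    x≡[x+s]-s = solve 2 (λ x s → x := x :+ s :- s) refl
    difference-of-squares : ∀ x s → (x - s) * (x + s) ≡ x * x - s * s
    difference-of-squares = solve 2 (λ x s → (x :- s) :* (x :+ s) := x :* x :- s :* s) refl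
    x≡y⇒x-y≡0 : ∀ {x y} → x ≡ y → x - y ≡ 0#
    x≡y⇒x-y≡0 {x} refl = -‿inverseʳ x
    x-s≢0 : x - s ≢ 0#
    x-s≢0 = x≢s ∘ x-y≡0⇒x≡y

  χ : Carrier → ℤ
  χ x with x ≟ 0# | isSquare? x
  ... | yes _ | _ = 0ℤ
  ... | no _ | yes _ = 1ℤ
  ... | no _ | no _ = -1ℤ

  χ-zero : ∀ {x} → x ≡ 0# → χ x ≡ 0ℤ
  χ-zero {x} x≡0 with x ≟ 0#
  ... | yes _ = refl
  ... | no x≢0 = contradiction x≡0 x≢0

  χ-square : ∀ {x} → x ≢ 0# → IsSquare x → χ x ≡ 1ℤ
  χ-square {x} x≢0 □x with x ≟ 0# | isSquare? x
  ... | yes x≡0 | _ = contradiction x≡0 x≢0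
  ... | no _ | yes _ = refl
  ... | no _ | no ¬□x = contradiction □x ¬□x

  χ-nonSquare : ∀ {x} → x ≢ 0# → ¬ IsSquare x → χ x ≡ -1ℤ
  χ-nonSquare {x} x≢0 ¬□x with x ≟ 0# | isSquare? x
  ... | yes x≡0 | _ = contradiction x≡0 x≢0
  ... | no _ | yes □x = contradiction □x ¬□x
  ... | no _ | no _ = refl

  χ≢-1⇒square : ∀ {x} → χ x ≢ -1ℤ → IsSquare x
  χ≢-1⇒square {x} χx≢-1 with x ≟ 0# | isSquare? x
  ... | yes refl | _ = 0# , zeroˡ 0#
  ... | no _ | yes □x = □x
  ... | no _ | no _ = contradiction refl χx≢-1

  χ≤1 : ∀ x → χ x ≤ℤ 1ℤ
  χ≤1 x with x ≟ 0# | isSquare? x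
  ... | yes _ | _ = +≤+ ℕ.z≤n
  ... | no _ | yes _ = ℤₚ.≤-refl
  ... | no _ | no _ = -≤+

  χ²≡1 : ∀ {x} → x ≢ 0# → χ x *ℤ χ x ≡ 1ℤ
  χ²≡1 {x} x≢0 with x ≟ 0# | isSquare? x
  ... | yes x≡0 | _ = contradiction x≡0 x≢0
  ... | no _ | yes _ = refl
  ... | no _ | no _ = refl

  #square-roots : ∀ y → ∑ (λ x → δ y (x * x)) ≡ 1ℤ +ℤ χ y
  #square-roots y with y ≟ 0# | isSquare? y
  ... | yes y≡0 | _ = trans (∑-single _ 0# (λ x x≢0 → δ-off (λ x²≡y → x*y≢0 x≢0 x≢0 (trans x²≡y y≡0))))
                            (δ-on (trans (zeroˡ 0#) (sym y≡0)))
  ... | no y≢0 | yes (s , s²≡y) = trans (∑-cong two-roots) (trans (∑-+ (δ s) (δ (- s))) (cong₂ _+ℤ_ (∑-δ s) (∑-δ (- s))))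
    where
    s≢0 : s ≢ 0#
    s≢0 s≡0 = y≢0 (trans (sym s²≡y) (trans (cong (_* s) s≡0) (zeroˡ s)))
    neg-square : ∀ s → - s * - s ≡ s * s
    neg-square = solve 1 (λ s → :- s :* :- s := s :* s) refl
    two-roots : ∀ x → δ y (x * x) ≡ δ s x +ℤ δ (- s) x
    two-roots x with x ≟ s | x ≟ (- s)
    ... | yes x≡s | yes x≡-s = contradiction (trans (sym x≡s) x≡-s) (x≢-x s≢0)
    ... | yes x≡s | no _ = δ-on (trans (cong₂ _*_ x≡s x≡s) s²≡y)
    ... | no _ | yes x≡-s = δ-on (trans (cong₂ _*_ x≡-s x≡-s) (trans (neg-square s) s²≡y))
    ... | no x≢s | no x≢-s = δ-off (λ x²≡y → [ x≢s , x≢-s ] (square-roots (trans x²≡y (sym s²≡y))))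
  ... | no _ | no ¬□y = trans (∑-cong (λ x → δ-off (λ x²≡y → ¬□y (x , x²≡y)))) ∑-zero

  ∑χ≡0 : ∑ χ ≡ 0ℤ
  ∑χ≡0 = begin
    ∑ χ                                     ≡⟨ a≡b+a-b (∑ χ) (∑ (λ _ → 1ℤ)) ⟩
    ∑ (λ _ → 1ℤ) +ℤ ∑ χ -ℤ ∑ (λ _ → 1ℤ)     ≡⟨ cong (_-ℤ ∑ (λ _ → 1ℤ)) (sym (∑-+ (λ _ → 1ℤ) χ)) ⟩
    ∑ (λ y → 1ℤ +ℤ χ y) -ℤ ∑ (λ _ → 1ℤ)     ≡⟨ cong (_-ℤ ∑ (λ _ → 1ℤ)) count-pairs ⟩
    ∑ (λ _ → 1ℤ) -ℤ ∑ (λ _ → 1ℤ)            ≡⟨ ℤₚ.+-inverseʳ (∑ (λ _ → 1ℤ)) ⟩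
    0ℤ                                      ∎
    where
    open ≡-Reasoning
    a≡b+a-b : ∀ a b → a ≡ b +ℤ a -ℤ b
    a≡b+a-b = solve-∀
    -- both sides count the pairs (x, y) with x * x = y
    count-pairs : ∑ (λ y → 1ℤ +ℤ χ y) ≡ ∑ (λ _ → 1ℤ)
    count-pairs = trans (sym (∑-cong #square-roots)) (trans (∑-comm (λ y x → δ y (x * x))) (∑-cong (λ x → ∑-δ′ (x * x))))

  square-* : ∀ {a b} → IsSquare a → IsSquare b → IsSquare (a * b)
  square-* (s , s²≡a) (t , t²≡b) = s * t , trans (interchange s t) (cong₂ _*_ s²≡a t²≡b)
    where
    interchange : ∀ s t → s * t * (s * t) ≡ s * s * (t * t)
    interchange = solve 2 (λ s t → s :* t :* (s :* t) := s :* s :* (t :* t)) refl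

  square-*-nonSquare : ∀ {a b} → a ≢ 0# → IsSquare a → ¬ IsSquare b → ¬ IsSquare (a * b)
  square-*-nonSquare {a} {b} a≢0 (s , s²≡a) ¬□b (t , t²≡ab) = ¬□b (t * s ⁻¹ , (begin
    t * s ⁻¹ * (t * s ⁻¹)          ≡⟨ interchange t (s ⁻¹) ⟩
    t * t * (s ⁻¹ * s ⁻¹)          ≡⟨ cong (_* (s ⁻¹ * s ⁻¹)) (trans t²≡ab (cong (_* b) (sym s²≡a))) ⟩
    s * s * b * (s ⁻¹ * s ⁻¹)      ≡⟨ regroup s b (s ⁻¹) ⟩
    s * s ⁻¹ * (s * s ⁻¹) * b      ≡⟨ cong (λ u → u * u * b) (x*x⁻¹≡1 s≢0) ⟩
    1# * 1# * b                    ≡⟨ trans (cong (_* b) (*-identityˡ 1#)) (*-identityˡ b) ⟩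
    b                              ∎))
    where
    open ≡-Reasoning
    s≢0 : s ≢ 0#
    s≢0 s≡0 = a≢0 (trans (sym s²≡a) (trans (cong (_* s) s≡0) (zeroˡ s)))
    interchange : ∀ s t → s * t * (s * t) ≡ s * s * (t * t)
    interchange = solve 2 (λ s t → s :* t :* (s :* t) := s :* s :* (t :* t)) refl
    regroup : ∀ s b r → s * s * b * (r * r) ≡ s * r * (s * r) * b
    regroup = solve 3 (λ s b r → s :* s :* b :* (r :* r) := s :* r :* (s :* r) :* b) refl

  -- Otherwise x ↦ χ (a * x) + χ x would be ≤ 0 everywhere with sum 0, yet equal -2 at b.
  nonSquare-*-nonSquare : ∀ {a b} → a ≢ 0# → ¬ IsSquare a → b ≢ 0# → ¬ IsSquare b → IsSquare (a * b)
  nonSquare-*-nonSquare {a} {b} a≢0 ¬□a b≢0 ¬□b with isSquare? (a * b)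
  ... | yes □ab = □ab
  ... | no ¬□ab = contradiction (ℤₚ.≤-trans (ℤₚ.≤-reflexive (sym ∑f≡0)) (∑-≤-at f b f≤0)) f[b]≱0
    where
    f : Carrier → ℤ
    f x = χ (a * x) +ℤ χ x
    ∑f≡0 : ∑ f ≡ 0ℤ
    ∑f≡0 = trans (∑-+ (λ x → χ (a * x)) χ) (cong₂ _+ℤ_ (trans (∑-scale a≢0 χ) ∑χ≡0) ∑χ≡0)
    f≤0 : ∀ x → f x ≤ℤ 0ℤ
    f≤0 x with x ≟ 0# | isSquare? x
    ... | yes refl | _ = ℤₚ.≤-reflexive (cong (_+ℤ 0ℤ) (χ-zero (zeroʳ a)))
    ... | no x≢0 | yes □x = ℤₚ.≤-reflexive (cong (_+ℤ 1ℤ) (χ-nonSquare (x*y≢0 a≢0 x≢0) ¬□ax))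
      where
      ¬□ax : ¬ IsSquare (a * x)
      ¬□ax □ax = square-*-nonSquare x≢0 □x ¬□a (subst IsSquare (*-comm a x) □ax)
    ... | no _ | no _ = ℤₚ.+-monoˡ-≤ -1ℤ (χ≤1 (a * x))
    f[b]≡-2 : f b ≡ -1ℤ +ℤ -1ℤ
    f[b]≡-2 = cong₂ _+ℤ_ (χ-nonSquare (x*y≢0 a≢0 b≢0) ¬□ab) (χ-nonSquare b≢0 ¬□b)
    f[b]≱0 : ¬ (0ℤ ≤ℤ f b)
    f[b]≱0 0≤f[b] = contradiction (ℤₚ.≤-trans 0≤f[b] (ℤₚ.≤-reflexive f[b]≡-2)) λ ()

  χ-* : ∀ a b → χ (a * b) ≡ χ a *ℤ χ b
  χ-* a b = by-cases (a ≟ 0#) (b ≟ 0#) (isSquare? a) (isSquare? b)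
    where
    by-cases : Dec (a ≡ 0#) → Dec (b ≡ 0#) → Dec (IsSquare a) → Dec (IsSquare b) → χ (a * b) ≡ χ a *ℤ χ b
    by-cases (yes a≡0) _ _ _ =
      trans (χ-zero (trans (cong (_* b) a≡0) (zeroˡ b))) (sym (trans (cong (_*ℤ χ b) (χ-zero a≡0)) (ℤₚ.*-zeroˡ (χ b))))
    by-cases (no _) (yes b≡0) _ _ =
      trans (χ-zero (trans (cong (_*_ a) b≡0) (zeroʳ a))) (sym (trans (cong (_*ℤ_ (χ a)) (χ-zero b≡0)) (ℤₚ.*-zeroʳ (χ a))))
    by-cases (no a≢0) (no b≢0) (yes □a) (yes □b) = trans
      (χ-square (x*y≢0 a≢0 b≢0) (square-* □a □b))
      (sym (cong₂ _*ℤ_ (χ-square a≢0 □a) (χ-square b≢0 □b)))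
    by-cases (no a≢0) (no b≢0) (yes □a) (no ¬□b) = trans
      (χ-nonSquare (x*y≢0 a≢0 b≢0) (square-*-nonSquare a≢0 □a ¬□b))
      (sym (cong₂ _*ℤ_ (χ-square a≢0 □a) (χ-nonSquare b≢0 ¬□b)))
    by-cases (no a≢0) (no b≢0) (no ¬□a) (yes □b) = trans
      (χ-nonSquare (x*y≢0 a≢0 b≢0) (λ □ab → square-*-nonSquare b≢0 □b ¬□a (subst IsSquare (*-comm a b) □ab)))
      (sym (cong₂ _*ℤ_ (χ-nonSquare a≢0 ¬□a) (χ-square b≢0 □b)))
    by-cases (no a≢0) (no b≢0) (no ¬□a) (no ¬□b) = trans
      (χ-square (x*y≢0 a≢0 b≢0) (nonSquare-*-nonSquare a≢0 ¬□a b≢0 ¬□b))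
      (sym (cong₂ _*ℤ_ (χ-nonSquare a≢0 ¬□a) (χ-nonSquare b≢0 ¬□b)))

  -- If every a² + b² were a square, induction would make every n · 1 a square,
  -- including -1 = (characteristic - 1) · 1.
  sumOfSquares-nonSquare : ¬ IsSquare (- 1#) → ∃[ a ] ∃[ b ] χ (a * a + b * b) ≡ -1ℤ
  sumOfSquares-nonSquare ¬□-1 with Finₚ.any? (λ i → Finₚ.any? (λ j → χ (to i * to i + to j * to j) ℤₚ.≟ -1ℤ))
  ... | yes (i , j , χ≡-1) = to i , to j , χ≡-1
  ... | no ∄ = contradiction (subst IsSquare e×1≡-1 (multiple-square e)) ¬□-1
    where
    sumOfSquares-square : ∀ a b → IsSquare (a * a + b * b)
    sumOfSquares-square a b = χ≢-1⇒square λ χ≡-1 → ∄ (from a , from b ,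
      subst₂ (λ u v → χ (u * u + v * v) ≡ -1ℤ) (sym (strictlyInverseˡ a)) (sym (strictlyInverseˡ b)) χ≡-1)
    multiple-square : ∀ k → IsSquare (k × 1#)
    multiple-square zero = 0# , zeroˡ 0#
    multiple-square (suc k) with multiple-square k
    ... | s , s²≡k×1 = subst IsSquare (cong₂ _+_ (*-identityˡ 1#) s²≡k×1) (sumOfSquares-square 1# s)
    e : ℕ
    e = proj₁ characteristic
    e×1≡-1 : e × 1# ≡ - 1#
    e×1≡-1 = +-inverseʳ-unique 1# (e × 1#) (proj₂ characteristic)

  nonzeroSquare : Carrier → ℤ
  nonzeroSquare x with x ≟ 0# | isSquare? x
  ... | yes _ | _ = 0ℤ
  ... | no _ | yes _ = 1ℤ
  ... | no _ | no _ = 0ℤ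

  ∑-nonzeroSquare : + 2 *ℤ ∑ nonzeroSquare ≡ + q -ℤ 1ℤ
  ∑-nonzeroSquare = begin
    + 2 *ℤ ∑ nonzeroSquare
      ≡⟨ sym (∑-*ˡ (+ 2) nonzeroSquare) ⟩
    ∑ (λ x → + 2 *ℤ nonzeroSquare x)
      ≡⟨ ∑-cong 2*nonzeroSquare ⟩
    ∑ (λ x → 1ℤ -ℤ δ 0# x +ℤ χ x)
      ≡⟨ ∑-+ (λ x → 1ℤ -ℤ δ 0# x) χ ⟩
    ∑ (λ x → 1ℤ -ℤ δ 0# x) +ℤ ∑ χ
      ≡⟨ cong₂ _+ℤ_ (∑-+ (λ _ → 1ℤ) (λ x → -ℤ δ 0# x)) ∑χ≡0 ⟩
    ∑ (λ _ → 1ℤ) +ℤ ∑ (λ x → -ℤ δ 0# x) +ℤ 0ℤ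
      ≡⟨ cong₂ (λ s t → s +ℤ t +ℤ 0ℤ) (∑-const 1ℤ) (trans (∑-neg (δ 0#)) (cong -ℤ_ (∑-δ 0#))) ⟩
    + q *ℤ 1ℤ -ℤ 1ℤ +ℤ 0ℤ
      ≡⟨ q*1-1+0≡q-1 (+ q) ⟩
    + q -ℤ 1ℤ ∎
    where
    open ≡-Reasoning
    q*1-1+0≡q-1 : ∀ q → q *ℤ 1ℤ -ℤ 1ℤ +ℤ 0ℤ ≡ q -ℤ 1ℤ
    q*1-1+0≡q-1 = solve-∀
    2*nonzeroSquare : ∀ x → + 2 *ℤ nonzeroSquare x ≡ 1ℤ -ℤ δ 0# x +ℤ χ x
    2*nonzeroSquare x with x ≟ 0# | isSquare? x
    ... | yes _ | _ = refl
    ... | no _ | yes _ = refl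
    ... | no _ | no _ = refl

  module _ (q≡3 : q % 4 ≡ 3) where
    private
      q≢1+4*h : ∀ h → + q ≢ 1ℤ +ℤ + 4 *ℤ h
      q≢1+4*h (+ k) q≡1+4k with trans (sym (DivMod.[m+kn]%n≡m%n 1 k 4)) (trans (cong (_% 4) (sym q≡1+k*4)) q≡3)
        where
        q≡1+k*4 : q ≡ 1 ℕ.+ k ℕ.* 4
        q≡1+k*4 = ℤₚ.+-injective (trans q≡1+4k (cong (1ℤ +ℤ_) (trans (sym (ℤₚ.pos-* 4 k)) (cong +_ (ℕₚ.*-comm 4 k)))))
      ... | ()
      q≢1+4*h -[1+ zero ] ()
      q≢1+4*h -[1+ suc k ] ()

    -- If -1 were a square, negation would pair off the nonzero squares, whose
    -- number (q - 1) / 2 would then be even.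
    -1-nonSquare : ¬ IsSquare (- 1#)
    -1-nonSquare □-1 = q-1≢4h (∑-even -_ -‿involutive nonzeroSquare nonzeroSquare-neg nonzeroSquare-fixed)
      where
      -1≢0 : - 1# ≢ 0#
      -1≢0 -1≡0 = 0≢1 (sym (trans (sym (-‿involutive 1#)) (trans (cong -_ -1≡0) -0#≈0#)))
      □-neg : ∀ {x} → IsSquare x → IsSquare (- x)
      □-neg {x} □x = subst IsSquare (-1*x≈-x x) (square-* □-1 □x)
      nonzeroSquare-neg : ∀ x → nonzeroSquare (- x) ≡ nonzeroSquare x
      nonzeroSquare-neg x with x ≟ 0# | isSquare? x | (- x) ≟ 0# | isSquare? (- x)
      ... | yes _ | _ | yes _ | _ = refl
      ... | yes refl | _ | no -0≢0 | _ = contradiction -0#≈0# -0≢0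
      ... | no x≢0 | _ | yes -x≡0 | _ = contradiction (trans (sym (-‿involutive x)) (trans (cong -_ -x≡0) -0#≈0#)) x≢0
      ... | no _ | yes _ | no _ | yes _ = refl
      ... | no _ | yes □x | no _ | no ¬□-x = contradiction (□-neg □x) ¬□-x
      ... | no _ | no ¬□x | no _ | yes □-x = contradiction (subst IsSquare (-‿involutive x) (□-neg □-x)) ¬□x
      ... | no _ | no _ | no _ | no _ = refl
      nonzeroSquare-fixed : ∀ x → - x ≡ x → nonzeroSquare x ≡ 0ℤ
      nonzeroSquare-fixed x -x≡x with x ≟ 0#
      ... | yes _ = refl
      ... | no x≢0 = contradiction (sym -x≡x) (x≢-x x≢0)
      q-1≢4h : ¬ (∃[ h ] ∑ nonzeroSquare ≡ + 2 *ℤ h)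
      q-1≢4h (h , ∑≡2h) = q≢1+4*h h (begin
        + q                              ≡⟨ q≡1+[q-1] (+ q) ⟩
        1ℤ +ℤ (+ q -ℤ 1ℤ)                ≡⟨ cong (_+ℤ_ 1ℤ) (sym ∑-nonzeroSquare) ⟩
        1ℤ +ℤ + 2 *ℤ ∑ nonzeroSquare     ≡⟨ cong (λ t → 1ℤ +ℤ + 2 *ℤ t) ∑≡2h ⟩
        1ℤ +ℤ + 2 *ℤ (+ 2 *ℤ h)          ≡⟨ cong (_+ℤ_ 1ℤ) (sym (ℤₚ.*-assoc (+ 2) (+ 2) h)) ⟩
        1ℤ +ℤ + 4 *ℤ h                   ∎)
        where
        open ≡-Reasoning
        q≡1+[q-1] : ∀ q → q ≡ 1ℤ +ℤ (q -ℤ 1ℤ)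
        q≡1+[q-1] = solve-∀

module MultiplicativeCharacterSums {n : ℕ} (K : FiniteField n) where
  open FieldTheory K
  open import Data.Integer using () renaming (_+_ to _+ℤ_; _*_ to _*ℤ_; -_ to -ℤ_; _-_ to _-ℤ_)

  module _ (η : Carrier → ℤ)
           (η-* : ∀ x y → η (x * y) ≡ η x *ℤ η y)
           (η-0 : η 0# ≡ 0ℤ)
           (η²≡1 : ∀ {x} → x ≢ 0# → η x *ℤ η x ≡ 1ℤ)
           (η-nontrivial : ∃[ w ] η w ≡ -1ℤ)
           where

    η-1 : η 1# ≡ 1ℤ
    η-1 = trans (cong η (sym (*-identityˡ 1#))) (trans (η-* 1# 1#) (η²≡1 (0≢1 ∘ sym)))

    η-⁻¹ : ∀ x → η (x ⁻¹) ≡ η x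
    η-⁻¹ x = by-cases (x ≟ 0#)
      where
      by-cases : Dec (x ≡ 0#) → η (x ⁻¹) ≡ η x
      by-cases (yes refl) = cong η 0⁻¹≡0
      by-cases (no x≢0) = begin
        η (x ⁻¹)
          ≡⟨ sym (ℤₚ.*-identityˡ _) ⟩
        1ℤ *ℤ η (x ⁻¹)
          ≡⟨ cong (_*ℤ η (x ⁻¹)) (sym (η²≡1 x≢0)) ⟩
        η x *ℤ η x *ℤ η (x ⁻¹)
          ≡⟨ ℤₚ.*-assoc (η x) (η x) (η (x ⁻¹)) ⟩
        η x *ℤ (η x *ℤ η (x ⁻¹))
          ≡⟨ cong (_*ℤ_ (η x)) (trans (sym (η-* x (x ⁻¹))) (trans (cong η (x*x⁻¹≡1 x≢0)) η-1)) ⟩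
        η x *ℤ 1ℤ
          ≡⟨ ℤₚ.*-identityʳ (η x) ⟩
        η x ∎
        where open ≡-Reasoning

    -- Scaling by w with η w = -1 permutes the field and negates every term.
    ∑η≡0 : ∑ η ≡ 0ℤ
    ∑η≡0 = ℤₚ.*-cancelˡ-≡ (+ 2) (∑ η) 0ℤ (begin
      + 2 *ℤ ∑ η                    ≡⟨ 2a≡a-[-1]a (∑ η) ⟩
      ∑ η -ℤ -1ℤ *ℤ ∑ η             ≡⟨ cong (λ c → ∑ η -ℤ c *ℤ ∑ η) (sym ηw≡-1) ⟩
      ∑ η -ℤ η w *ℤ ∑ η             ≡⟨ cong (_-ℤ_ (∑ η)) (sym (∑-*ˡ (η w) η)) ⟩
      ∑ η -ℤ ∑ (λ x → η w *ℤ η x)   ≡⟨ cong (_-ℤ_ (∑ η)) (trans (sym (∑-cong (η-* w))) (∑-scale w≢0 η)) ⟩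
      ∑ η -ℤ ∑ η                    ≡⟨ ℤₚ.+-inverseʳ (∑ η) ⟩
      0ℤ                            ≡⟨ sym (ℤₚ.*-zeroʳ (+ 2)) ⟩
      + 2 *ℤ 0ℤ                     ∎)
      where
      open ≡-Reasoning
      w : Carrier
      w = proj₁ η-nontrivial
      ηw≡-1 : η w ≡ -1ℤ
      ηw≡-1 = proj₂ η-nontrivial
      2a≡a-[-1]a : ∀ a → + 2 *ℤ a ≡ a -ℤ -1ℤ *ℤ a
      2a≡a-[-1]a = solve-∀
      w≢0 : w ≢ 0#
      w≢0 refl with trans (sym ηw≡-1) η-0
      ... | ()

    ∑η² : ∑ (λ z → η z *ℤ η z) ≡ + n *ℤ 1ℤ -ℤ 1ℤ
    ∑η² = begin
      ∑ (λ z → η z *ℤ η z)                  ≡⟨ ∑-cong η²≡1-δ₀ ⟩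
      ∑ (λ z → 1ℤ -ℤ δ 0# z)                ≡⟨ ∑-+ (λ _ → 1ℤ) (λ z → -ℤ δ 0# z) ⟩
      ∑ (λ _ → 1ℤ) +ℤ ∑ (λ z → -ℤ δ 0# z)   ≡⟨ cong₂ _+ℤ_ (∑-const 1ℤ) (trans (∑-neg (δ 0#)) (cong -ℤ_ (∑-δ 0#))) ⟩
      + n *ℤ 1ℤ -ℤ 1ℤ                       ∎
      where
      open ≡-Reasoning
      η²≡1-δ₀ : ∀ z → η z *ℤ η z ≡ 1ℤ -ℤ δ 0# z
      η²≡1-δ₀ z with z ≟ 0#
      ... | yes refl = cong (λ c → c *ℤ c) η-0
      ... | no z≢0 = η²≡1 z≢0

    -- φ z = 1 - d z⁻¹ permutes K (sending 0 to 1) and η (φ z) = η z η (z - d) for z ≠ 0,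
    -- so this Jacobi sum is ∑ η - η 1.
    jacobi : ∀ {d} → d ≢ 0# → ∑ (λ z → η z *ℤ η (z - d)) ≡ -1ℤ
    jacobi {d} d≢0 = begin
      ∑ (λ z → η z *ℤ η (z - d))
        ≡⟨ a≡a+1-1 _ ⟩
      ∑ (λ z → η z *ℤ η (z - d)) +ℤ 1ℤ -ℤ 1ℤ
        ≡⟨ cong (λ t → ∑ (λ z → η z *ℤ η (z - d)) +ℤ t -ℤ 1ℤ) (sym (∑-δ 0#)) ⟩
      ∑ (λ z → η z *ℤ η (z - d)) +ℤ ∑ (δ 0#) -ℤ 1ℤ
        ≡⟨ cong (_-ℤ 1ℤ) (sym (∑-+ (λ z → η z *ℤ η (z - d)) (δ 0#))) ⟩
      ∑ (λ z → η z *ℤ η (z - d) +ℤ δ 0# z) -ℤ 1ℤ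
        ≡⟨ cong (_-ℤ 1ℤ) (sym (∑-cong η∘φ)) ⟩
      ∑ (η ∘ φ) -ℤ 1ℤ
        ≡⟨ cong (_-ℤ 1ℤ) (trans (∑-reindex (mk↔ₛ′ φ ψ φ∘ψ ψ∘φ) η) ∑η≡0) ⟩
      -1ℤ ∎
      where
      open ≡-Reasoning
      a≡a+1-1 : ∀ a → a ≡ a +ℤ 1ℤ -ℤ 1ℤ
      a≡a+1-1 = solve-∀

      φ ψ : Carrier → Carrier
      φ z = 1# - d * z ⁻¹
      ψ v = d * (1# - v) ⁻¹

      1-[1-v]≡v : ∀ v → 1# - (1# - v) ≡ v
      1-[1-v]≡v = solve 2 (λ o v → o :- (o :- v) := v) refl 1#

      φ∘ψ : ∀ v → φ (ψ v) ≡ v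
      φ∘ψ v = begin
        1# - d * (d * (1# - v) ⁻¹) ⁻¹          ≡⟨ cong (λ t → 1# - d * t) (⁻¹-distrib-* d ((1# - v) ⁻¹)) ⟩
        1# - d * (d ⁻¹ * (1# - v) ⁻¹ ⁻¹)       ≡⟨ cong (λ t → 1# - d * (d ⁻¹ * t)) (⁻¹-involutive (1# - v)) ⟩
        1# - d * (d ⁻¹ * (1# - v))             ≡⟨ cong (_-_ 1#) (x*[y*z]≡z (x*x⁻¹≡1 d≢0) (1# - v)) ⟩
        1# - (1# - v)                          ≡⟨ 1-[1-v]≡v v ⟩
        v                                      ∎

      ψ∘φ : ∀ z → ψ (φ z) ≡ z
      ψ∘φ z = begin
        d * (1# - (1# - d * z ⁻¹)) ⁻¹          ≡⟨ cong (λ t → d * t ⁻¹) (1-[1-v]≡v (d * z ⁻¹)) ⟩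
        d * (d * z ⁻¹) ⁻¹                      ≡⟨ cong (_*_ d) (⁻¹-distrib-* d (z ⁻¹)) ⟩
        d * (d ⁻¹ * z ⁻¹ ⁻¹)                   ≡⟨ cong (λ t → d * (d ⁻¹ * t)) (⁻¹-involutive z) ⟩
        d * (d ⁻¹ * z)                         ≡⟨ x*[y*z]≡z (x*x⁻¹≡1 d≢0) z ⟩
        z                                      ∎

      η∘φ : ∀ z → η (φ z) ≡ η z *ℤ η (z - d) +ℤ δ 0# z
      η∘φ z = by-cases (z ≟ 0#)
        where
        by-cases : Dec (z ≡ 0#) → η (φ z) ≡ η z *ℤ η (z - d) +ℤ δ 0# z
        by-cases (yes refl) = begin
          η (1# - d * 0# ⁻¹)              ≡⟨ cong (λ t → η (1# - d * t)) 0⁻¹≡0 ⟩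
          η (1# - d * 0#)                 ≡⟨ cong η (1-d*0≡1 1# d) ⟩
          η 1#                            ≡⟨ η-1 ⟩
          0ℤ *ℤ η (0# - d) +ℤ 1ℤ          ≡⟨ sym (cong₂ (λ a b → a *ℤ η (0# - d) +ℤ b) η-0 (δ-on refl)) ⟩
          η 0# *ℤ η (0# - d) +ℤ δ 0# 0#   ∎
          where
          1-d*0≡1 : ∀ o d → o - d * 0# ≡ o
          1-d*0≡1 = solve 2 (λ o d → o :- d :* con 0ℤ := o) refl
        by-cases (no z≢0) = begin
          η (1# - d * z ⁻¹)               ≡⟨ cong (λ t → η (t - d * z ⁻¹)) (sym (x*x⁻¹≡1 z≢0)) ⟩
          η (z * z ⁻¹ - d * z ⁻¹)         ≡⟨ cong η (sym (distribute z d (z ⁻¹))) ⟩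
          η ((z - d) * z ⁻¹)              ≡⟨ η-* (z - d) (z ⁻¹) ⟩
          η (z - d) *ℤ η (z ⁻¹)           ≡⟨ cong (_*ℤ_ (η (z - d))) (η-⁻¹ z) ⟩
          η (z - d) *ℤ η z                ≡⟨ ℤₚ.*-comm (η (z - d)) (η z) ⟩
          η z *ℤ η (z - d)                ≡⟨ sym (ℤₚ.+-identityʳ (η z *ℤ η (z - d))) ⟩
          η z *ℤ η (z - d) +ℤ 0ℤ          ≡⟨ cong (_+ℤ_ (η z *ℤ η (z - d))) (sym (δ-off z≢0)) ⟩
          η z *ℤ η (z - d) +ℤ δ 0# z      ∎
          where
          distribute : ∀ z d r → (z - d) * r ≡ z * r - d * r
          distribute = solve 3 (λ z d r → (z :- d) :* r := z :* r :- d :* r) refl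

    ∑-column : ∀ Y → ∑ (λ X → η (Y - X)) ≡ 0ℤ
    ∑-column Y = trans (∑-reflect Y η) ∑η≡0

    ∑-gram : ∀ Y Z → ∑ (λ X → η (Y - X) *ℤ η (Z - X)) ≡ + n *ℤ δ Y Z -ℤ 1ℤ
    ∑-gram Y Z = begin
      ∑ (λ X → η (Y - X) *ℤ η (Z - X))   ≡⟨ ∑-cong (λ X → cong (λ t → η (Y - X) *ℤ η t) (rearrange Y Z X)) ⟩
      ∑ (λ X → shifted (Y - X))          ≡⟨ ∑-reflect Y shifted ⟩
      ∑ shifted                          ≡⟨ by-cases (Z ≟ Y) ⟩
      + n *ℤ δ Y Z -ℤ 1ℤ                 ∎
      where
      open ≡-Reasoning
      shifted : Carrier → ℤ
      shifted u = η u *ℤ η (u - (Y - Z))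
      rearrange : ∀ Y Z X → Z - X ≡ Y - X - (Y - Z)
      rearrange = solve 3 (λ Y Z X → Z :- X := Y :- X :- (Y :- Z)) refl
      u-0≡u : ∀ u → u - 0# ≡ u
      u-0≡u = solve 1 (λ u → u :- con 0ℤ := u) refl
      by-cases : Dec (Z ≡ Y) → ∑ shifted ≡ + n *ℤ δ Y Z -ℤ 1ℤ
      by-cases (yes refl) = begin
        ∑ (λ u → η u *ℤ η (u - (Z - Z)))  ≡⟨ ∑-cong (λ u → cong (λ t → η u *ℤ η (u - t)) (-‿inverseʳ Z)) ⟩
        ∑ (λ u → η u *ℤ η (u - 0#))       ≡⟨ ∑-cong (λ u → cong (λ t → η u *ℤ η t) (u-0≡u u)) ⟩
        ∑ (λ u → η u *ℤ η u)              ≡⟨ ∑η² ⟩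
        + n *ℤ 1ℤ -ℤ 1ℤ                   ≡⟨ cong (λ t → + n *ℤ t -ℤ 1ℤ) (sym (δ-on refl)) ⟩
        + n *ℤ δ Z Z -ℤ 1ℤ                ∎
      by-cases (no Z≢Y) = begin
        ∑ shifted                ≡⟨ jacobi (Z≢Y ∘ sym ∘ x-y≡0⇒x≡y) ⟩
        -1ℤ                      ≡⟨ cong (_-ℤ 1ℤ) (sym (trans (cong (_*ℤ_ (+ n)) (δ-off Z≢Y)) (ℤₚ.*-zeroʳ (+ n)))) ⟩
        + n *ℤ δ Y Z -ℤ 1ℤ       ∎

module GaussianExtension {q : ℕ} (𝔽 : FiniteField q) (q-odd : q % 2 ≡ 1)
  (-1-nonSquare : ¬ FiniteField.IsSquare 𝔽 (FiniteField.-_ 𝔽 (FiniteField.1# 𝔽))) where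
  open FieldTheory 𝔽
  open QuadraticCharacter 𝔽 q-odd using (χ; χ-*; χ-zero; χ²≡1; sumOfSquares-nonSquare)
  open import Data.Integer using () renaming (_*_ to _*ℤ_)

  infixl 6 _+ᵢ_
  infixl 7 _*ᵢ_
  infix 8 -ᵢ_

  _+ᵢ_ _*ᵢ_ : Point → Point → Point
  (a , b) +ᵢ (c , d) = a + c , b + d
  (a , b) *ᵢ (c , d) = a * c - b * d , a * d + b * c

  -ᵢ_ : Point → Point
  -ᵢ (a , b) = - a , - b

  0ᵢ 1ᵢ : Point
  0ᵢ = 0# , 0#
  1ᵢ = 1# , 0#

  N : Point → Carrier
  N (a , b) = a * a + b * b

  N-* : ∀ z w → N (z *ᵢ w) ≡ N z * N w
  N-* (a , b) (c , d) = brahmagupta a b c d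
    where
    brahmagupta : ∀ a b c d → (a * c - b * d) * (a * c - b * d) + (a * d + b * c) * (a * d + b * c)
                              ≡ (a * a + b * b) * (c * c + d * d)
    brahmagupta = solve 4 (λ a b c d → (a :* c :- b :* d) :* (a :* c :- b :* d) :+ (a :* d :+ b :* c) :* (a :* d :+ b :* c)
                                       := (a :* a :+ b :* b) :* (c :* c :+ d :* d)) refl

  N-neg : ∀ z → N (-ᵢ z) ≡ N z
  N-neg (a , b) = cong₂ _+_ (neg-square a) (neg-square b)
    where
    neg-square : ∀ a → - a * - a ≡ a * a
    neg-square = solve 1 (λ a → :- a :* :- a := a :* a) refl

  N≡0⇒≡0 : ∀ {z} → N z ≡ 0# → z ≡ 0ᵢ
  N≡0⇒≡0 {a , b} a²+b²≡0 with b ≟ 0#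
  ... | yes refl = cong (_, 0#) (square≡0 (trans (sym (a²+0²≡a² a)) a²+b²≡0))
    where
    a²+0²≡a² : ∀ a → a * a + 0# * 0# ≡ a * a
    a²+0²≡a² = solve 1 (λ a → a :* a :+ con 0ℤ :* con 0ℤ := a :* a) refl
    square≡0 : a * a ≡ 0# → a ≡ 0#
    square≡0 a²≡0 with a ≟ 0#
    ... | yes a≡0 = a≡0
    ... | no a≢0 = x*y≡0⇒y≡0 a≢0 a²≡0
  ... | no b≢0 = contradiction (a * b ⁻¹ , (begin
    a * b ⁻¹ * (a * b ⁻¹)
      ≡⟨ interchange a (b ⁻¹) ⟩
    a * a * (b ⁻¹ * b ⁻¹)
      ≡⟨ cong (_* (b ⁻¹ * b ⁻¹)) (+-inverseʳ-unique (b * b) (a * a) (trans (+-comm (b * b) (a * a)) a²+b²≡0)) ⟩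
    - (b * b) * (b ⁻¹ * b ⁻¹)
      ≡⟨ regroup b (b ⁻¹) ⟩
    - (b * b ⁻¹ * (b * b ⁻¹))
      ≡⟨ cong (λ u → - (u * u)) (x*x⁻¹≡1 b≢0) ⟩
    - (1# * 1#)
      ≡⟨ cong -_ (*-identityˡ 1#) ⟩
    - 1# ∎)) -1-nonSquare
    where
    open ≡-Reasoning
    interchange : ∀ s t → s * t * (s * t) ≡ s * s * (t * t)
    interchange = solve 2 (λ s t → s :* t :* (s :* t) := s :* s :* (t :* t)) refl
    regroup : ∀ b r → - (b * b) * (r * r) ≡ - (b * r * (b * r))
    regroup = solve 2 (λ b r → :- (b :* b) :* (r :* r) := :- (b :* r :* (b :* r))) refl

  inverseᵢ : ∀ z → z ≢ 0ᵢ → ∃[ w ] z *ᵢ w ≡ 1ᵢ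
  inverseᵢ z@(a , b) z≢0 = (a * r , - (b * r)) , cong₂ _,_
    (trans (real-part a b r) (trans (*-comm (N z) r) (x⁻¹*x≡1 (z≢0 ∘ N≡0⇒≡0))))
    (imaginary-part a b r)
    where
    r : Carrier
    r = N z ⁻¹
    real-part : ∀ a b r → a * (a * r) - b * - (b * r) ≡ (a * a + b * b) * r
    real-part = solve 3 (λ a b r → a :* (a :* r) :- b :* :- (b :* r) := (a :* a :+ b :* b) :* r) refl
    imaginary-part : ∀ a b r → a * - (b * r) + b * (a * r) ≡ 0#
    imaginary-part = solve 3 (λ a b r → a :* :- (b :* r) :+ b :* (a :* r) := con 0ℤ) refl

  isCommutativeRingᵢ : IsCommutativeRing _≡_ _+ᵢ_ _*ᵢ_ -ᵢ_ 0ᵢ 1ᵢ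
  isCommutativeRingᵢ = record
    { isRing = record
      { +-isAbelianGroup = record
        { isGroup = record
          { isMonoid = record
            { isSemigroup = record
              { isMagma = record { isEquivalence = isEquivalence ; ∙-cong = cong₂ _+ᵢ_ }
              ; assoc = λ where (a , b) (c , d) (e , f) → cong₂ _,_ (+-assoc a c e) (+-assoc b d f)
              }
            ; identity = (λ where (a , b) → cong₂ _,_ (+-identityˡ a) (+-identityˡ b))
                       , (λ where (a , b) → cong₂ _,_ (+-identityʳ a) (+-identityʳ b))
            }
          ; inverse = (λ where (a , b) → cong₂ _,_ (-‿inverseˡ a) (-‿inverseˡ b))
                    , (λ where (a , b) → cong₂ _,_ (-‿inverseʳ a) (-‿inverseʳ b))
          ; ⁻¹-cong = cong -ᵢ_
          }
        ; comm = λ where (a , b) (c , d) → cong₂ _,_ (+-comm a c) (+-comm b d)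
        }
      ; *-cong = cong₂ _*ᵢ_
      ; *-assoc = λ where (a , b) (c , d) (e , f) → cong₂ _,_ (assoc-re a b c d e f) (assoc-im a b c d e f)
      ; *-identity = (λ where (c , d) → cong₂ _,_ (identity-re c d) (identity-im c d))
                   , (λ where (c , d) → trans (*ᵢ-comm (c , d) 1ᵢ) (cong₂ _,_ (identity-re c d) (identity-im c d)))
      ; distrib = (λ where (a , b) (c , d) (e , f) → cong₂ _,_ (distrib-re a b c d e f) (distrib-im a b c d e f))
                , (λ where (a , b) (c , d) (e , f) → cong₂ _,_ (distrib-re′ a b c d e f) (distrib-im′ a b c d e f))
      }
    ; *-comm = *ᵢ-comm
    }
    where
    *ᵢ-comm : ∀ z w → z *ᵢ w ≡ w *ᵢ z
    *ᵢ-comm (a , b) (c , d) = cong₂ _,_ (comm-re a b c d) (comm-im a b c d)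
      where
      comm-re : ∀ a b c d → a * c - b * d ≡ c * a - d * b
      comm-re = solve 4 (λ a b c d → a :* c :- b :* d := c :* a :- d :* b) refl
      comm-im : ∀ a b c d → a * d + b * c ≡ c * b + d * a
      comm-im = solve 4 (λ a b c d → a :* d :+ b :* c := c :* b :+ d :* a) refl
    assoc-re : ∀ a b c d e f → (a * c - b * d) * e - (a * d + b * c) * f ≡ a * (c * e - d * f) - b * (c * f + d * e)
    assoc-re = solve 6 (λ a b c d e f → (a :* c :- b :* d) :* e :- (a :* d :+ b :* c) :* f
                                        := a :* (c :* e :- d :* f) :- b :* (c :* f :+ d :* e)) refl
    assoc-im : ∀ a b c d e f → (a * c - b * d) * f + (a * d + b * c) * e ≡ a * (c * f + d * e) + b * (c * e - d * f)
    assoc-im = solve 6 (λ a b c d e f → (a :* c :- b :* d) :* f :+ (a :* d :+ b :* c) :* e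
                                        := a :* (c :* f :+ d :* e) :+ b :* (c :* e :- d :* f)) refl
    identity-re : ∀ c d → 1# * c - 0# * d ≡ c
    identity-re c d = trans (cong₂ _-_ (*-identityˡ c) (zeroˡ d)) (trans (cong (_+_ c) -0#≈0#) (+-identityʳ c))
    identity-im : ∀ c d → 1# * d + 0# * c ≡ d
    identity-im c d = trans (cong₂ _+_ (*-identityˡ d) (zeroˡ c)) (+-identityʳ d)
    distrib-re : ∀ a b c d e f → a * (c + e) - b * (d + f) ≡ a * c - b * d + (a * e - b * f)
    distrib-re = solve 6 (λ a b c d e f → a :* (c :+ e) :- b :* (d :+ f) := a :* c :- b :* d :+ (a :* e :- b :* f)) refl
    distrib-im : ∀ a b c d e f → a * (d + f) + b * (c + e) ≡ a * d + b * c + (a * f + b * e)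
    distrib-im = solve 6 (λ a b c d e f → a :* (d :+ f) :+ b :* (c :+ e) := a :* d :+ b :* c :+ (a :* f :+ b :* e)) refl
    distrib-re′ : ∀ a b c d e f → (c + e) * a - (d + f) * b ≡ c * a - d * b + (e * a - f * b)
    distrib-re′ = solve 6 (λ a b c d e f → (c :+ e) :* a :- (d :+ f) :* b := c :* a :- d :* b :+ (e :* a :- f :* b)) refl
    distrib-im′ : ∀ a b c d e f → (c + e) * b + (d + f) * a ≡ c * b + d * a + (e * b + f * a)
    distrib-im′ = solve 6 (λ a b c d e f → (c :+ e) :* b :+ (d :+ f) :* a := c :* b :+ d :* a :+ (e :* b :+ f :* a)) refl

  𝔽[i] : FiniteField (q ℕ.* q)
  𝔽[i] = record
    { Carrier = Point
    ; _+_ = _+ᵢ_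
    ; _*_ = _*ᵢ_
    ; -_ = -ᵢ_
    ; 0# = 0ᵢ
    ; 1# = 1ᵢ
    ; isCommutativeRing = isCommutativeRingᵢ
    ; 0≢1 = 0≢1 ∘ cong proj₁
    ; inverse = inverseᵢ
    ; _≟_ = _≟P_
    ; enumeration = ↔-trans Finₚ.*↔× (enumeration ×-↔ enumeration)
    }

  η : Point → ℤ
  η z = χ (N z)

  η-* : ∀ z w → η (z *ᵢ w) ≡ η z *ℤ η w
  η-* z w = trans (cong χ (N-* z w)) (χ-* (N z) (N w))

  η-0 : η 0ᵢ ≡ 0ℤ
  η-0 = χ-zero (trans (cong₂ _+_ (zeroˡ 0#) (zeroˡ 0#)) (+-identityʳ 0#))

  η²≡1 : ∀ {z} → z ≢ 0ᵢ → η z *ℤ η z ≡ 1ℤ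
  η²≡1 z≢0 = χ²≡1 (z≢0 ∘ N≡0⇒≡0)

  η-nontrivial : ∃[ w ] η w ≡ -1ℤ
  η-nontrivial with sumOfSquares-nonSquare -1-nonSquare
  ... | a , b , χ≡-1 = (a , b) , χ≡-1

module QuadranceGraph {q : ℕ} (𝔽 : FiniteField q) (q-odd : q % 2 ≡ 1) (q≡3 : q % 4 ≡ 3) where
  open import Data.Integer using () renaming (_+_ to _+ℤ_; _*_ to _*ℤ_; _-_ to _-ℤ_; _≤_ to _≤ℤ_)
  open import Data.List using (filter)
  open import Data.List.Properties using (filter-accept; filter-reject)
  open import Data.Nat.Combinatorics using (_C_; nC1≡n; nCk+nC[k+1]≡[n+1]C[k+1])
  open FiniteField 𝔽 using (Point; 0#; quadrance; Adjacent; adjacent?; edges)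
  open QuadraticCharacter 𝔽 q-odd using (χ; χ-square; χ-nonSquare; -1-nonSquare)
  open GaussianExtension 𝔽 q-odd (-1-nonSquare q≡3)
  open FieldTheory 𝔽[i] using (_-_; -_; enumeration; _≟_; x-y≡0⇒x≡y; -‿inverseʳ; solve; _:=_; _:-_; :-_)
  open MultiplicativeCharacterSums 𝔽[i] using (∑-column; ∑-gram)
  open ListSum enumeration _≟_

  -- quadrance X Y is definitionally N (Y - X), so A X Y is χ of the quadrance.
  A : Point → Point → ℤ
  A X Y = η (Y - X)

  open QuadraticForm.Bound {Q = q} enumeration _≟_ A (∑-column η η-* η-0 η²≡1 η-nontrivial) (∑-gram η η-* η-0 η²≡1 η-nontrivial)

  A-adjacent : ∀ {X Y} → Adjacent X Y → A X Y ≡ 1ℤ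
  A-adjacent (_ , Q≢0 , □Q) = χ-square Q≢0 □Q

  A-nonadjacent : ∀ {X Y} → X ≢ Y → ¬ Adjacent X Y → A X Y ≡ -1ℤ
  A-nonadjacent {X} {Y} X≢Y ¬adj = χ-nonSquare Q≢0 (λ □Q → ¬adj (X≢Y , Q≢0 , □Q))
    where
    Q≢0 : quadrance X Y ≢ 0#
    Q≢0 Q≡0 = X≢Y (sym (x-y≡0⇒x≡y (N≡0⇒≡0 Q≡0)))

  A-diag : ∀ X → A X X ≡ 0ℤ
  A-diag X = trans (cong η (-‿inverseʳ X)) η-0

  A-sym : ∀ X Y → A X Y ≡ A Y X
  A-sym X Y = trans (cong χ (sym (N-neg (Y - X)))) (cong η (neg-difference X Y))
    where
    neg-difference : ∀ X Y → - (Y - X) ≡ X - Y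
    neg-difference = solve 2 (λ X Y → :- (Y :- X) := X :- Y) refl

  row : ∀ X U → All (X ≢_) U → ∑ₗ U (A X) ≡ + 2 *ℤ + length (filter (adjacent? X) U) -ℤ + length U
  row X [] [] = refl
  row X (Y ∷ U) (X≢Y ∷ X∉U) = by-cases (adjacent? X Y)
    where
    k n : ℤ
    k = + length (filter (adjacent? X) U)
    n = + length U
    by-cases : Dec (Adjacent X Y) → ∑ₗ (Y ∷ U) (A X) ≡ + 2 *ℤ + length (filter (adjacent? X) (Y ∷ U)) -ℤ + length (Y ∷ U)
    by-cases (yes adj) = begin
      A X Y +ℤ ∑ₗ U (A X)
        ≡⟨ cong₂ _+ℤ_ (A-adjacent adj) (row X U X∉U) ⟩
      1ℤ +ℤ (+ 2 *ℤ k -ℤ n)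
        ≡⟨ count k n ⟩
      + 2 *ℤ (1ℤ +ℤ k) -ℤ (1ℤ +ℤ n)
        ≡⟨ cong (λ t → + 2 *ℤ + length t -ℤ (1ℤ +ℤ n)) (sym (filter-accept (adjacent? X) adj)) ⟩
      + 2 *ℤ + length (filter (adjacent? X) (Y ∷ U)) -ℤ (1ℤ +ℤ n) ∎
      where
      open ≡-Reasoning
      count : ∀ k n → 1ℤ +ℤ (+ 2 *ℤ k -ℤ n) ≡ + 2 *ℤ (1ℤ +ℤ k) -ℤ (1ℤ +ℤ n)
      count = solve-∀
    by-cases (no ¬adj) = begin
      A X Y +ℤ ∑ₗ U (A X)
        ≡⟨ cong₂ _+ℤ_ (A-nonadjacent X≢Y ¬adj) (row X U X∉U) ⟩
      -1ℤ +ℤ (+ 2 *ℤ k -ℤ n)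
        ≡⟨ count k n ⟩
      + 2 *ℤ k -ℤ (1ℤ +ℤ n)
        ≡⟨ cong (λ t → + 2 *ℤ + length t -ℤ (1ℤ +ℤ n)) (sym (filter-reject (adjacent? X) ¬adj)) ⟩
      + 2 *ℤ + length (filter (adjacent? X) (Y ∷ U)) -ℤ (1ℤ +ℤ n) ∎
      where
      open ≡-Reasoning
      count : ∀ k n → -1ℤ +ℤ (+ 2 *ℤ k -ℤ n) ≡ + 2 *ℤ k -ℤ (1ℤ +ℤ n)
      count = solve-∀

  pairSum-edges : ∀ U → Unique U → pairSum A U ≡ + 2 *ℤ + edges U -ℤ + (length U C 2)
  pairSum-edges [] [] = refl
  pairSum-edges (X ∷ U) (X∉U ∷ U!) = begin
    ∑ₗ U (A X) +ℤ pairSum A U                         ≡⟨ cong₂ _+ℤ_ (row X U X∉U) (pairSum-edges U U!) ⟩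
    + 2 *ℤ + k -ℤ + n +ℤ (+ 2 *ℤ + e -ℤ + (n C 2))    ≡⟨ collect (+ k) (+ n) (+ e) (+ (n C 2)) ⟩
    + 2 *ℤ (+ k +ℤ + e) -ℤ (+ n +ℤ + (n C 2))         ≡⟨ cong (λ t → + 2 *ℤ + (k ℕ.+ e) -ℤ + t) pascal ⟩
    + 2 *ℤ + (k ℕ.+ e) -ℤ + (suc n C 2)               ∎
    where
    open ≡-Reasoning
    k n e : ℕ
    k = length (filter (adjacent? X) U)
    n = length U
    e = edges U
    collect : ∀ k n e c → + 2 *ℤ k -ℤ n +ℤ (+ 2 *ℤ e -ℤ c) ≡ + 2 *ℤ (k +ℤ e) -ℤ (n +ℤ c)
    collect = solve-∀
    pascal : n ℕ.+ n C 2 ≡ suc n C 2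
    pascal = trans (cong (ℕ._+ n C 2) (sym (nC1≡n n))) (nCk+nC[k+1]≡[n+1]C[k+1] n 1)

  edge-discrepancy : ∀ U → Unique U →
    + ∣ + (4 ℕ.* q ℕ.* edges U) -ℤ + (2 ℕ.* q ℕ.* (length U C 2)) ∣ ≤ℤ + length U *ℤ (+ (q ℕ.* q) -ℤ + length U)
  edge-discrepancy U U! = subst₂ _≤ℤ_ (cong (λ t → + ∣ t ∣) qT≡) M*D-s*s≡ (quadraticForm-bound {{q≢0}} x)
    where
    open FiniteSum enumeration _≟_ using (∑; ∑-cong)
    x : Point → ℤ
    x = multiplicity U
    u : ℤ
    u = + length U
    q≢0 : ℕ.NonZero q
    q≢0 = ℕ.≢-nonZero λ { refl → contradiction q-odd λ () }
    s≡u : ∑ x ≡ u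
    s≡u = trans (∑-cong (λ X → sym (ℤₚ.*-identityʳ (x X)))) (trans (∑-multiplicity U (λ _ → 1ℤ)) (∑ₗ-1 U))
    D≡u : ∑ (λ X → x X *ℤ x X) ≡ u
    D≡u = trans (∑-multiplicity U x) (∑ₗ-multiplicity U U!)
    T≡ : ∑ (λ X → x X *ℤ (A· x) X) ≡ + 2 *ℤ (+ 2 *ℤ + edges U -ℤ + (length U C 2))
    T≡ = begin
      ∑ (λ X → x X *ℤ (A· x) X)
        ≡⟨ ∑-multiplicity U (A· x) ⟩
      ∑ₗ U (A· x)
        ≡⟨ ∑ₗ-cong U (λ X → trans (∑-cong (λ Y → ℤₚ.*-comm (A X Y) (x Y))) (∑-multiplicity U (A X))) ⟩
      ∑ₗ U (λ X → ∑ₗ U (A X))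
        ≡⟨ ∑ₗ-∑ₗ≡2*pairSum A A-sym A-diag U ⟩
      + 2 *ℤ pairSum A U
        ≡⟨ cong (_*ℤ_ (+ 2)) (pairSum-edges U U!) ⟩
      + 2 *ℤ (+ 2 *ℤ + edges U -ℤ + (length U C 2)) ∎
      where open ≡-Reasoning
    qT≡ : + q *ℤ ∑ (λ X → x X *ℤ (A· x) X) ≡ + (4 ℕ.* q ℕ.* edges U) -ℤ + (2 ℕ.* q ℕ.* (length U C 2))
    qT≡ = trans (cong (_*ℤ_ (+ q)) T≡) (trans (expand (+ q) (+ edges U) (+ (length U C 2)))
                (sym (cong₂ _-ℤ_ (pos-*₃ 4 q (edges U)) (pos-*₃ 2 q (length U C 2)))))
      where
      expand : ∀ q e c → q *ℤ (+ 2 *ℤ (+ 2 *ℤ e -ℤ c)) ≡ + 4 *ℤ q *ℤ e -ℤ + 2 *ℤ q *ℤ c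
      expand = solve-∀
      pos-*₃ : ∀ a b c → + (a ℕ.* b ℕ.* c) ≡ + a *ℤ + b *ℤ + c
      pos-*₃ a b c = trans (ℤₚ.pos-* (a ℕ.* b) c) (cong (_*ℤ + c) (ℤₚ.pos-* a b))
    M*D-s*s≡ : + (q ℕ.* q) *ℤ ∑ (λ X → x X *ℤ x X) -ℤ ∑ x *ℤ ∑ x ≡ u *ℤ (+ (q ℕ.* q) -ℤ u)
    M*D-s*s≡ = trans (cong₂ (λ d t → + (q ℕ.* q) *ℤ d -ℤ t *ℤ t) D≡u s≡u) (factor (+ (q ℕ.* q)) u)
      where
      factor : ∀ m u → m *ℤ u -ℤ u *ℤ u ≡ u *ℤ (m -ℤ u)
      factor = solve-∀

open import Data.Nat using (ℕ; _%_; _*_)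
open import Data.Nat.Combinatorics using (_C_)
open import Data.Integer using (+_; _-_; ∣_∣; _≤_) renaming (_*_ to _*ℤ_)
open import Data.List using (List; length)
open import Data.List.Relation.Unary.Unique.Propositional using (Unique)
open import Relation.Binary.PropositionalEquality using (_≡_)

theorem5 : (q : ℕ) → IsPrimePower q → q % 2 ≡ 1 → q % 4 ≡ 3 →
    (𝔽 : FiniteField q) → (U : List (FiniteField.Point 𝔽)) → Unique U →
    + ∣ + (4 * q * FiniteField.edges 𝔽 U) - + (2 * q * (length U C 2)) ∣
      ≤ + length U *ℤ (+ (q * q) - + length U)
theorem5 q _ q-odd q≡3 𝔽 = QuadranceGraph.edge-discrepancy 𝔽 q-odd q≡3
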